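{- For $n\ge1$ let $\Lambda_n(x)=\sum_{k=1}^n\Lambda(n,k)x^k$ and $L_n(x)=\sum_k L(n,k)x^k$, and set $\Lambda_0(x)=L_0(x)=1$. Then $$\sum_{n\ge0}\Lambda_n(x)\frac{t^n}{n!}=\exp\Big(\sum_{n\ge0}x\,L_n(x^2)\frac{t^{n+1}}{(n+1)!}\Big).$$
   Context: For a permutation $\sigma=\sigma_1\cdots\sigma_n$ of $[n]$, prepend $\sigma_0=0$. An up-down run of $\sigma$ is a maximal segment of consecutive entries of $\sigma_0\sigma_1\cdots\sigma_n$ that is increasing or decreasing (consecutive runs share an endpoint); e.g. $0\,3\,7\,5\,8\,6\,1\,4\,9\,2$ has six up-down runs. $\Lambda(n,k)$ is the number of permutations of $[n]$ with exactly $k$ up-down runs. A left peak of $\sigma$ is an index $i$ with $1\le i\le n-1$ and $\sigma_{i-1}<\sigma_i>\sigma_{i+1}$ (with $\sigma_0=0$); $L(n,k)$ is the number of permutations of $[n]$ with exactly $k$ left peaks. -}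

module Defs where

open import Data.Nat as ℕ using (ℕ; zero; suc; _<ᵇ_; _≡ᵇ_; _∸_; _!)
open import Data.Nat.Properties using (_!≢0)
open import Data.Bool using (Bool; true; false; _∧_; _∨_; if_then_else_)
open import Data.List using (List; []; _∷_; map; concatMap; length; filter; upTo)
open import Data.Integer using (+_)
open import Data.Rational using (ℚ; 0ℚ; 1ℚ; _+_; _*_; _/_)

-- Permutations of [n] = {1,…,n}, as lists (one-line notation).

insertEverywhere : ℕ → List ℕ → List (List ℕ)
insertEverywhere a [] = (a ∷ []) ∷ []
insertEverywhere a (b ∷ bs) = (a ∷ b ∷ bs) ∷ map (b ∷_) (insertEverywhere a bs)

perms : ℕ → List (List ℕ)
perms zero = [] ∷ []
perms (suc n) = concatMap (insertEverywhere (suc n)) (perms n)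

peaksW : List ℕ → ℕ
peaksW (a ∷ b ∷ c ∷ w) =
  (if (a <ᵇ b) ∧ (c <ᵇ b) then 1 else 0) ℕ.+ peaksW (b ∷ c ∷ w)
peaksW _ = 0

turnsW : List ℕ → ℕ
turnsW (a ∷ b ∷ c ∷ w) =
  (if ((a <ᵇ b) ∧ (c <ᵇ b)) ∨ ((b <ᵇ a) ∧ (b <ᵇ c)) then 1 else 0)
    ℕ.+ turnsW (b ∷ c ∷ w)
turnsW _ = 0

leftPeaks : List ℕ → ℕ
leftPeaks σ = peaksW (0 ∷ σ)

-- number of up-down runs of σ (σ nonempty): the maximal monotone segments
-- of 0σ₁⋯σₙ; their number is 1 + (number of turning points).
udRuns : List ℕ → ℕ
udRuns σ = suc (turnsW (0 ∷ σ))

count : {A : Set} → (A → Bool) → List A → ℕ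
count p [] = 0
count p (x ∷ xs) = (if p x then 1 else 0) ℕ.+ count p xs

Λ : ℕ → ℕ → ℕ
Λ n k = count (λ σ → udRuns σ ≡ᵇ k) (perms n)

L : ℕ → ℕ → ℕ
L n k = count (λ σ → leftPeaks σ ≡ᵇ k) (perms n)

Λpoly : ℕ → ℕ → ℕ
Λpoly zero zero = 1
Λpoly zero (suc k) = 0
Λpoly (suc n) k = Λ (suc n) k

Lpoly : ℕ → ℕ → ℕ
Lpoly zero zero = 1
Lpoly zero (suc k) = 0
Lpoly (suc n) k = L (suc n) k

-- Formal power series in two variables t, x over ℚ:
-- F n k = coefficient of t^n x^k.

Series : Set
Series = ℕ → ℕ → ℚ

Σ≤ : ℕ → (ℕ → ℚ) → ℚ
Σ≤ zero f = f zero
Σ≤ (suc n) f = Σ≤ n f + f (suc n)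

oneS : Series
oneS zero zero = 1ℚ
oneS _ _ = 0ℚ

_⊛_ : Series → Series → Series
(F ⊛ G) n k = Σ≤ n λ i → Σ≤ k λ j → F i j * G (n ∸ i) (k ∸ j)

_^S_ : Series → ℕ → Series
F ^S zero = oneS
F ^S suc m = F ⊛ (F ^S m)

-- exp(F) = Σ_m F^m / m!, for F with zero constant term in t
-- (then F^m has t-order ≥ m, so only m ≤ n contributes to t^n).
expS : Series → Series
expS F n k = Σ≤ n λ m → (F ^S m) n k * ((+ 1 / (m !)) {{m !≢0}})

lhsSeries : Series
lhsSeries n k = (+ Λpoly n k / (n !)) {{n !≢0}}

isOdd : ℕ → Bool
isOdd zero = false
isOdd (suc zero) = true
isOdd (suc (suc k)) = isOdd k

half : ℕ → ℕ
half zero = zero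
half (suc zero) = zero
half (suc (suc k)) = suc (half k)

-- coefficient of x^k in x·L_n(x²)
xLsq : ℕ → ℕ → ℕ
xLsq n k = if isOdd k then Lpoly n (half k) else 0

innerSeries : Series
innerSeries zero k = 0ℚ
innerSeries (suc n) k = (+ xLsq n k / (suc n !)) {{suc n !≢0}}

-- Inserting n + 1 into the permutations of [n] in all possible positions gives the recurrences
--   L(n+1,k) = (2k+1) L(n,k) + (n-2k+2) L(n,k-1),
--   Λ(n+1,k) = k Λ(n,k) + Λ(n,k-1) + (n-k+2) Λ(n,k-2),
-- since inserting next to a peak or at the end keeps the left peaks and every other slot adds one,
-- and similarly for turning points. With B_i(x) = x L_i(x²) these say that Λ_{n+1} and B_{i+1} arise
-- from Λ_n and B_i by first-order differential operators in x whose parameters add up under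
-- products (Leibniz rule), so Λ_{n+1} = Σ_i C(n,i) B_i Λ_{n-i} by induction on n. After dividing by
-- factorials, both sides F of the theorem satisfy n F_n = Σ_i i G_i F_{n-i} for the inner series G,
-- i.e. ∂_t F = ∂_t G · F, with F_0 = 1, and this recursion determines F.

module Submission where

open import Defs
open import Algebra.Bundles using (CommutativeSemiring; CommutativeRing)
open import Data.Nat using (ℕ)
open import Relation.Binary.PropositionalEquality as ≡ using (_≡_)

module Sequences {c ℓ} (R : CommutativeSemiring c ℓ) where

  open import Data.Nat as ℕ using (ℕ; zero; suc; _∸_; _≤_; _<_; z≤n; s≤s)
  import Data.Nat.Properties as ℕ
  open import Data.Product using (_,_)
  open import Relation.Binary.Structures using (IsEquivalence)

  open CommutativeSemiring R hiding (zero) renaming (Carrier to A)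
  open import Algebra.Properties.Semiring.Mult semiring public
    using (_×_; ×-congʳ; ×-homo-+; ×-assoc-*; ×-comm-*)
  open import Algebra.Properties.CommutativeMonoid.Mult +-commutativeMonoid
    using (×-distrib-+)
  open import Algebra.Properties.CommutativeSemigroup +-commutativeSemigroup
    using (interchange)
  open import Algebra.Structures.Biased using (isCommutativeSemiringˡ)
  open import Relation.Binary.Reasoning.Setoid setoid

  ×-zeroʳ : ∀ n → n × 0# ≈ 0#
  ×-zeroʳ zero = refl
  ×-zeroʳ (suc n) = trans (+-identityˡ _) (×-zeroʳ n)

  ∑ : ℕ → (ℕ → A) → A
  ∑ zero f = f zero
  ∑ (suc n) f = ∑ n f + f (suc n)

  ∑-cong-≤ : ∀ n {f g : ℕ → A} → (∀ i → i ≤ n → f i ≈ g i) → ∑ n f ≈ ∑ n g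
  ∑-cong-≤ zero f≈g = f≈g zero z≤n
  ∑-cong-≤ (suc n) f≈g =
    +-cong (∑-cong-≤ n (λ i i≤n → f≈g i (ℕ.m≤n⇒m≤1+n i≤n))) (f≈g (suc n) ℕ.≤-refl)

  ∑-cong : ∀ n {f g : ℕ → A} → (∀ i → f i ≈ g i) → ∑ n f ≈ ∑ n g
  ∑-cong n f≈g = ∑-cong-≤ n (λ i _ → f≈g i)

  ∑-zero : ∀ n {f : ℕ → A} → (∀ i → i ≤ n → f i ≈ 0#) → ∑ n f ≈ 0#
  ∑-zero zero f≈0 = f≈0 zero z≤n
  ∑-zero (suc n) f≈0 = trans
    (+-cong (∑-zero n (λ i i≤n → f≈0 i (ℕ.m≤n⇒m≤1+n i≤n))) (f≈0 (suc n) ℕ.≤-refl))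
    (+-identityˡ 0#)

  ∑-distrib-+ : ∀ n (f g : ℕ → A) → ∑ n (λ i → f i + g i) ≈ ∑ n f + ∑ n g
  ∑-distrib-+ zero f g = refl
  ∑-distrib-+ (suc n) f g =
    trans (+-congʳ (∑-distrib-+ n f g)) (interchange _ _ _ _)

  *-distribˡ-∑ : ∀ n a (f : ℕ → A) → a * ∑ n f ≈ ∑ n (λ i → a * f i)
  *-distribˡ-∑ zero a f = refl
  *-distribˡ-∑ (suc n) a f = trans (distribˡ a _ _) (+-congʳ (*-distribˡ-∑ n a f))

  *-distribʳ-∑ : ∀ n a (f : ℕ → A) → ∑ n f * a ≈ ∑ n (λ i → f i * a)
  *-distribʳ-∑ zero a f = refl
  *-distribʳ-∑ (suc n) a f = trans (distribʳ a _ _) (+-congʳ (*-distribʳ-∑ n a f))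

  ×-distrib-∑ : ∀ k n f → k × ∑ n f ≈ ∑ n (λ i → k × f i)
  ×-distrib-∑ k zero f = refl
  ×-distrib-∑ k (suc n) f = trans (×-distrib-+ _ _ k) (+-congʳ (×-distrib-∑ k n f))

  ∑-peel : ∀ n (f : ℕ → A) → ∑ (suc n) f ≈ f zero + ∑ n (λ i → f (suc i))
  ∑-peel zero f = refl
  ∑-peel (suc n) f = trans (+-congʳ (∑-peel n f)) (+-assoc _ _ _)

  ∑-comm : ∀ n m (f : ℕ → ℕ → A) →
    ∑ n (λ i → ∑ m (λ j → f i j)) ≈ ∑ m (λ j → ∑ n (λ i → f i j))
  ∑-comm zero m f = refl
  ∑-comm (suc n) m f =
    trans (+-congʳ (∑-comm n m f)) (sym (∑-distrib-+ m _ _))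

  ∑-reverse : ∀ n (f : ℕ → A) → ∑ n f ≈ ∑ n (λ i → f (n ∸ i))
  ∑-reverse zero f = refl
  ∑-reverse (suc n) f = begin
    ∑ n f + f (suc n)                     ≈⟨ +-comm _ _ ⟩
    f (suc n) + ∑ n f                     ≈⟨ +-congˡ (∑-reverse n f) ⟩
    f (suc n) + ∑ n (λ i → f (n ∸ i))     ≈⟨ ∑-peel n _ ⟨
    ∑ (suc n) (λ i → f (suc n ∸ i))       ∎

  ∑-triangle : ∀ n (g : ℕ → ℕ → A) →
    ∑ n (λ s → ∑ s (λ i → g i s)) ≈ ∑ n (λ i → ∑ (n ∸ i) (λ t → g i (i ℕ.+ t)))
  ∑-triangle zero g = refl
  ∑-triangle (suc n) g = begin
    ∑ n (λ s → ∑ s (λ i → g i s)) + ∑ (suc n) (λ i → g i (suc n))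
      ≈⟨ +-congʳ (∑-triangle n g) ⟩
    ∑ n (λ i → ∑ (n ∸ i) (λ t → g i (i ℕ.+ t))) + (∑ n (λ i → g i (suc n)) + g (suc n) (suc n))
      ≈⟨ +-assoc _ _ _ ⟨
    ∑ n (λ i → ∑ (n ∸ i) (λ t → g i (i ℕ.+ t))) + ∑ n (λ i → g i (suc n)) + g (suc n) (suc n)
      ≈⟨ +-cong (trans (sym (∑-distrib-+ n _ _)) (∑-cong-≤ n extendRow)) (reflexive (≡.cong (g (suc n)) (≡.sym (ℕ.+-identityʳ (suc n))))) ⟩
    ∑ n (λ i → ∑ (suc n ∸ i) (λ t → g i (i ℕ.+ t))) + g (suc n) (suc n ℕ.+ 0)
      ≈⟨ +-congˡ (reflexive (≡.cong (λ m → ∑ m (λ t → g (suc n) (suc n ℕ.+ t))) (≡.sym (ℕ.n∸n≡0 n)))) ⟩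
    ∑ (suc n) (λ i → ∑ (suc n ∸ i) (λ t → g i (i ℕ.+ t))) ∎
    where
    extendRow : ∀ i → i ≤ n → ∑ (n ∸ i) (λ t → g i (i ℕ.+ t)) + g i (suc n) ≈ ∑ (suc n ∸ i) (λ t → g i (i ℕ.+ t))
    extendRow i i≤n rewrite ℕ.+-∸-assoc 1 i≤n =
      +-congˡ (reflexive (≡.cong (g i) (≡.sym (≡.trans (ℕ.+-suc i (n ∸ i)) (≡.cong suc (ℕ.m+[n∸m]≡n i≤n))))))

  Seq : Set c
  Seq = ℕ → A

  infixl 7 _⋆_
  _⋆_ : Seq → Seq → Seq
  (f ⋆ g) n = ∑ n (λ i → f i * g (n ∸ i))

  δ : Seq
  δ zero = 1#
  δ (suc n) = 0#

  ∂ : Seq → Seq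
  ∂ f n = n × f n

  ⋆-cong : ∀ {f f′ g g′ : Seq} → (∀ i → f i ≈ f′ i) → (∀ i → g i ≈ g′ i) →
           ∀ n → (f ⋆ g) n ≈ (f′ ⋆ g′) n
  ⋆-cong f≈f′ g≈g′ n = ∑-cong n (λ i → *-cong (f≈f′ i) (g≈g′ (n ∸ i)))

  ⋆-comm : ∀ f g n → (f ⋆ g) n ≈ (g ⋆ f) n
  ⋆-comm f g n = trans (∑-reverse n _) (∑-cong-≤ n (λ i i≤n →
    trans (*-comm _ _) (*-congʳ (reflexive (≡.cong g (ℕ.m∸[m∸n]≡n i≤n))))))

  ⋆-assoc : ∀ f g h n → ((f ⋆ g) ⋆ h) n ≈ (f ⋆ (g ⋆ h)) n
  ⋆-assoc f g h n = begin
    ∑ n (λ s → ∑ s (λ i → f i * g (s ∸ i)) * h (n ∸ s))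
      ≈⟨ ∑-cong n (λ s → *-distribʳ-∑ s _ _) ⟩
    ∑ n (λ s → ∑ s (λ i → f i * g (s ∸ i) * h (n ∸ s)))
      ≈⟨ ∑-triangle n _ ⟩
    ∑ n (λ i → ∑ (n ∸ i) (λ t → f i * g (i ℕ.+ t ∸ i) * h (n ∸ (i ℕ.+ t))))
      ≈⟨ ∑-cong n (λ i → ∑-cong (n ∸ i) (λ t → trans (*-assoc _ _ _) (*-congˡ (*-cong
           (reflexive (≡.cong g (ℕ.m+n∸m≡n i t)))
           (reflexive (≡.cong h (≡.sym (ℕ.∸-+-assoc n i t)))))))) ⟩
    ∑ n (λ i → ∑ (n ∸ i) (λ t → f i * (g t * h (n ∸ i ∸ t))))
      ≈⟨ ∑-cong n (λ i → *-distribˡ-∑ (n ∸ i) _ _) ⟨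
    ∑ n (λ i → f i * ∑ (n ∸ i) (λ t → g t * h (n ∸ i ∸ t))) ∎

  ⋆-identityˡ : ∀ f n → (δ ⋆ f) n ≈ f n
  ⋆-identityˡ f zero = *-identityˡ _
  ⋆-identityˡ f (suc n) = begin
    ∑ (suc n) (λ i → δ i * f (suc n ∸ i))          ≈⟨ ∑-peel n _ ⟩
    1# * f (suc n) + ∑ n (λ i → 0# * f (n ∸ i))     ≈⟨ +-cong (*-identityˡ _) (∑-zero n (λ i _ → zeroˡ _)) ⟩
    f (suc n) + 0#                                   ≈⟨ +-identityʳ _ ⟩
    f (suc n)                                        ∎

  ⋆-identityʳ : ∀ f n → (f ⋆ δ) n ≈ f n
  ⋆-identityʳ f n = trans (⋆-comm f δ n) (⋆-identityˡ f n)

  ⋆-distribˡ : ∀ f g h n → (f ⋆ (λ i → g i + h i)) n ≈ (f ⋆ g) n + (f ⋆ h) n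
  ⋆-distribˡ f g h n = trans (∑-cong n (λ i → distribˡ _ _ _)) (∑-distrib-+ n _ _)

  ⋆-distribʳ : ∀ f g h n → ((λ i → f i + g i) ⋆ h) n ≈ (f ⋆ h) n + (g ⋆ h) n
  ⋆-distribʳ f g h n = trans (∑-cong n (λ i → distribʳ _ _ _)) (∑-distrib-+ n _ _)

  ⋆-×ʳ : ∀ k f g n → (f ⋆ (λ i → k × g i)) n ≈ k × (f ⋆ g) n
  ⋆-×ʳ k f g n = trans (∑-cong n (λ i → ×-comm-* k _ _)) (sym (×-distrib-∑ k n _))

  ⋆-zeroʳ : ∀ f g n → (∀ i → g i ≈ 0#) → (f ⋆ g) n ≈ 0#
  ⋆-zeroʳ f g n g≈0 = ∑-zero n (λ i _ → trans (*-congˡ (g≈0 _)) (zeroʳ _))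

  ∂-leibniz : ∀ f g n → ∂ (f ⋆ g) n ≈ (∂ f ⋆ g) n + (f ⋆ ∂ g) n
  ∂-leibniz f g n = begin
    n × ∑ n (λ i → f i * g (n ∸ i))                               ≈⟨ ×-distrib-∑ n n _ ⟩
    ∑ n (λ i → n × (f i * g (n ∸ i)))                             ≈⟨ ∑-cong-≤ n split ⟩
    ∑ n (λ i → (i × f i) * g (n ∸ i) + f i * ((n ∸ i) × g (n ∸ i))) ≈⟨ ∑-distrib-+ n _ _ ⟩
    (∂ f ⋆ g) n + (f ⋆ ∂ g) n                                      ∎
    where
    split : ∀ i → i ≤ n → n × (f i * g (n ∸ i)) ≈ (i × f i) * g (n ∸ i) + f i * ((n ∸ i) × g (n ∸ i))
    split i i≤n = begin
      n × (f i * g (n ∸ i))                                   ≡⟨ ≡.cong (_× (f i * g (n ∸ i))) (ℕ.m+[n∸m]≡n i≤n) ⟨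
      (i ℕ.+ (n ∸ i)) × (f i * g (n ∸ i))                     ≈⟨ ×-homo-+ _ i (n ∸ i) ⟩
      i × (f i * g (n ∸ i)) + (n ∸ i) × (f i * g (n ∸ i))     ≈⟨ +-cong (×-assoc-* i _ _) (×-comm-* (n ∸ i) _ _) ⟨
      (i × f i) * g (n ∸ i) + f i * ((n ∸ i) × g (n ∸ i))     ∎

  X : Seq → Seq
  X f zero = 0#
  X f (suc n) = f n

  X-cong : ∀ {f g} → (∀ n → f n ≈ g n) → ∀ n → X f n ≈ X g n
  X-cong f≈g zero = refl
  X-cong f≈g (suc n) = f≈g n

  X-⋆ˡ : ∀ f g n → X (f ⋆ g) n ≈ (X f ⋆ g) n
  X-⋆ˡ f g zero = sym (zeroˡ _)
  X-⋆ˡ f g (suc n) = sym (trans (∑-peel n _) (trans (+-congʳ (zeroˡ _)) (+-identityˡ _)))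

  X-⋆ʳ : ∀ f g n → X (f ⋆ g) n ≈ (f ⋆ X g) n
  X-⋆ʳ f g n = trans (X-cong (⋆-comm f g) n) (trans (X-⋆ˡ g f n) (⋆-comm (X g) f n))

  ∂-cong : ∀ {f g} → (∀ n → f n ≈ g n) → ∀ n → ∂ f n ≈ ∂ g n
  ∂-cong f≈g n = ×-congʳ n (f≈g n)

  X-+ : ∀ f g n → X (λ i → f i + g i) n ≈ X f n + X g n
  X-+ f g zero = sym (+-identityˡ 0#)
  X-+ f g (suc n) = refl

  ⋆-*ˡ : ∀ a f g n → ((λ i → a * f i) ⋆ g) n ≈ a * (f ⋆ g) n
  ⋆-*ˡ a f g n = trans (∑-cong n (λ i → *-assoc _ _ _)) (sym (*-distribˡ-∑ n a _))

  ⋆-*ʳ : ∀ a f g n → (f ⋆ (λ i → a * g i)) n ≈ a * (f ⋆ g) n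
  ⋆-*ʳ a f g n = trans (⋆-comm f _ n) (trans (⋆-*ˡ a g f n) (*-congˡ (⋆-comm g f n)))

  XX∂-⋆ : ∀ f g n → X (X (∂ (f ⋆ g))) n ≈ (X (X (∂ f)) ⋆ g) n + (f ⋆ X (X (∂ g))) n
  XX∂-⋆ f g n = begin
    X (X (∂ (f ⋆ g))) n                                       ≈⟨ X-cong (X-cong (∂-leibniz f g)) n ⟩
    X (X (λ i → (∂ f ⋆ g) i + (f ⋆ ∂ g) i)) n                 ≈⟨ X-cong (X-+ (∂ f ⋆ g) (f ⋆ ∂ g)) n ⟩
    X (λ i → X (∂ f ⋆ g) i + X (f ⋆ ∂ g) i) n                 ≈⟨ X-+ (X (∂ f ⋆ g)) (X (f ⋆ ∂ g)) n ⟩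
    X (X (∂ f ⋆ g)) n + X (X (f ⋆ ∂ g)) n                     ≈⟨ +-cong (trans (X-cong (X-⋆ˡ (∂ f) g) n) (X-⋆ˡ (X (∂ f)) g n))
                                                                         (trans (X-cong (X-⋆ʳ f (∂ g)) n) (X-⋆ʳ f (X (∂ g)) n)) ⟩
    (X (X (∂ f)) ⋆ g) n + (f ⋆ X (X (∂ g))) n                 ∎

  ∂-∑ : ∀ n (w : ℕ → A) (T : ℕ → Seq) k → ∂ (λ j → ∑ n (λ i → w i * T i j)) k ≈ ∑ n (λ i → w i * ∂ (T i) k)
  ∂-∑ n w T k = trans (×-distrib-∑ k n _) (∑-cong n (λ i → sym (×-comm-* k (w i) (T i k))))

  X-∑ : ∀ n (w : ℕ → A) (T : ℕ → Seq) k → X (λ j → ∑ n (λ i → w i * T i j)) k ≈ ∑ n (λ i → w i * X (T i) k)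
  X-∑ n w T zero = sym (∑-zero n (λ i _ → zeroʳ (w i)))
  X-∑ n w T (suc k) = refl

  ∂-equation-unique : (∀ n {x y} → suc n × x ≈ suc n × y → x ≈ y) → ∀ {G F F′} → F 0 ≈ F′ 0 →
    (∀ n → ∂ F (suc n) ≈ (∂ G ⋆ F) (suc n)) → (∀ n → ∂ F′ (suc n) ≈ (∂ G ⋆ F′) (suc n)) → ∀ n → F n ≈ F′ n
  ∂-equation-unique ×-cancel {G} {F} {F′} F₀≈F′₀ eqF eqF′ n = upTo n n ℕ.≤-refl
    where
    upTo : ∀ n m → m ≤ n → F m ≈ F′ m
    upTo n zero _ = F₀≈F′₀
    upTo (suc n) (suc m) (s≤s m≤n) = ×-cancel m (begin
      ∂ F (suc m)             ≈⟨ eqF m ⟩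
      (∂ G ⋆ F) (suc m)       ≈⟨ ∑-cong (suc m) term ⟩
      (∂ G ⋆ F′) (suc m)      ≈⟨ eqF′ m ⟨
      ∂ F′ (suc m)            ∎)
      where
      -- ∂ G 0 is 0#, so F (suc m) itself does not enter
      term : ∀ i → ∂ G i * F (suc m ∸ i) ≈ ∂ G i * F′ (suc m ∸ i)
      term zero = trans (zeroˡ _) (sym (zeroˡ _))
      term (suc i) = *-congˡ (upTo n (m ∸ i) (ℕ.≤-trans (ℕ.m∸n≤m m i) m≤n))

  _≋_ : Seq → Seq → Set ℓ
  f ≋ g = ∀ n → f n ≈ g n

  _⊕_ : Seq → Seq → Seq
  (f ⊕ g) n = f n + g n

  seqSemiring : CommutativeSemiring c ℓ
  seqSemiring = record
    { Carrier = Seq ; _≈_ = _≋_ ; _+_ = _⊕_ ; _*_ = _⋆_ ; 0# = λ _ → 0# ; 1# = δ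
    ; isCommutativeSemiring = isCommutativeSemiringˡ record
      { +-isCommutativeMonoid = record
        { isMonoid = record
          { isSemigroup = record
            { isMagma = record { isEquivalence = ≋-isEquivalence ; ∙-cong = λ e e′ n → +-cong (e n) (e′ n) }
            ; assoc = λ f g h n → +-assoc _ _ _ }
          ; identity = (λ f n → +-identityˡ _) , (λ f n → +-identityʳ _) }
        ; comm = λ f g n → +-comm _ _ }
      ; *-isCommutativeMonoid = record
        { isMonoid = record
          { isSemigroup = record
            { isMagma = record { isEquivalence = ≋-isEquivalence ; ∙-cong = ⋆-cong }
            ; assoc = ⋆-assoc }
          ; identity = ⋆-identityˡ , ⋆-identityʳ }
        ; comm = ⋆-comm }
      ; distribʳ = λ f g h → ⋆-distribʳ g h f
      ; zeroˡ = λ f n → ∑-zero n (λ i _ → zeroˡ _) } }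
    where
    ≋-isEquivalence : IsEquivalence _≋_
    ≋-isEquivalence = record
      { refl = λ n → refl ; sym = λ e n → sym (e n) ; trans = λ e e′ n → trans (e n) (e′ n) }

  module Exponential (G : Seq) (G₀≈0 : G 0 ≈ 0#) (e : ℕ → A)
                     (e-rec : ∀ m → suc m × e (suc m) ≈ e m) where

    infixr 8 G^_
    G^_ : ℕ → Seq
    G^ zero = δ
    G^ suc m = G ⋆ G^ m

    -- e m stands for 1/m!; stopping at m = n loses nothing because G^ m has order at least m
    exp : Seq
    exp n = ∑ n (λ m → (G^ m) n * e m)

    G^-vanishes : ∀ m n → n < m → (G^ m) n ≈ 0#
    G^-vanishes (suc m) n (s≤s n≤m) = ∑-zero n term≈0
      where
      term≈0 : ∀ i → i ≤ n → G i * (G^ m) (n ∸ i) ≈ 0#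
      term≈0 zero _ = trans (*-congʳ G₀≈0) (zeroˡ _)
      term≈0 (suc i) i≤n = trans (*-congˡ (G^-vanishes m (n ∸ suc i)
        (ℕ.<-≤-trans (ℕ.∸-monoʳ-< (s≤s z≤n) i≤n) n≤m))) (zeroʳ _)

    exp-truncation : ∀ n N → n ≤ N → ∑ N (λ m → (G^ m) n * e m) ≈ exp n
    exp-truncation n N n≤N with ℕ.m≤n⇒∃[o]m+o≡n n≤N
    ... | d , ≡.refl = extend d
      where
      extend : ∀ d → ∑ (n ℕ.+ d) (λ m → (G^ m) n * e m) ≈ exp n
      extend zero rewrite ℕ.+-identityʳ n = refl
      extend (suc d) rewrite ℕ.+-suc n d = trans
        (+-cong (extend d) (trans (*-congʳ (G^-vanishes (suc (n ℕ.+ d)) n (s≤s (ℕ.m≤m+n n d)))) (zeroˡ _)))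
        (+-identityʳ _)

    ∂δ≈0 : ∀ n → ∂ δ n ≈ 0#
    ∂δ≈0 zero = refl
    ∂δ≈0 (suc n) = ×-zeroʳ (suc n)

    ∂-G^suc : ∀ m n → ∂ (G^ suc m) n ≈ suc m × (∂ G ⋆ G^ m) n
    ∂-G^suc zero n = trans (∂-leibniz G δ n) (+-congˡ (⋆-zeroʳ G (∂ δ) n ∂δ≈0))
    ∂-G^suc (suc m) n = begin
      ∂ (G ⋆ G^ suc m) n                                          ≈⟨ ∂-leibniz G (G^ suc m) n ⟩
      (∂ G ⋆ G^ suc m) n + (G ⋆ ∂ (G^ suc m)) n                    ≈⟨ +-congˡ (⋆-cong (λ _ → refl) (∂-G^suc m) n) ⟩
      (∂ G ⋆ G^ suc m) n + (G ⋆ (λ i → suc m × (∂ G ⋆ G^ m) i)) n  ≈⟨ +-congˡ (⋆-×ʳ (suc m) G (∂ G ⋆ G^ m) n) ⟩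
      (∂ G ⋆ G^ suc m) n + suc m × (G ⋆ (∂ G ⋆ G^ m)) n            ≈⟨ +-congˡ (×-congʳ (suc m) exchange) ⟩
      (∂ G ⋆ G^ suc m) n + suc m × (∂ G ⋆ G^ suc m) n              ∎
      where
      exchange : (G ⋆ (∂ G ⋆ G^ m)) n ≈ (∂ G ⋆ (G ⋆ G^ m)) n
      exchange = begin
        (G ⋆ (∂ G ⋆ G^ m)) n  ≈⟨ ⋆-assoc G (∂ G) (G^ m) n ⟨
        ((G ⋆ ∂ G) ⋆ G^ m) n  ≈⟨ ⋆-cong {g = G^ m} (⋆-comm G (∂ G)) (λ _ → refl) n ⟩
        ((∂ G ⋆ G) ⋆ G^ m) n  ≈⟨ ⋆-assoc (∂ G) G (G^ m) n ⟩
        (∂ G ⋆ (G ⋆ G^ m)) n  ∎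

    ∂G^suc-weighted : ∀ m n → ∂ (G^ suc m) n * e (suc m) ≈ (∂ G ⋆ G^ m) n * e m
    ∂G^suc-weighted m n = begin
      ∂ (G^ suc m) n * e (suc m)               ≈⟨ *-congʳ (∂-G^suc m n) ⟩
      suc m × (∂ G ⋆ G^ m) n * e (suc m)       ≈⟨ ×-assoc-* (suc m) _ _ ⟩
      suc m × ((∂ G ⋆ G^ m) n * e (suc m))     ≈⟨ ×-comm-* (suc m) _ _ ⟨
      (∂ G ⋆ G^ m) n * (suc m × e (suc m))     ≈⟨ *-congˡ (e-rec m) ⟩
      (∂ G ⋆ G^ m) n * e m                     ∎

    ∂-exp : ∀ n → ∂ exp n ≈ (∂ G ⋆ exp) n
    ∂-exp zero = sym (zeroˡ _)
    ∂-exp (suc n) = begin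
      suc n × ∑ (suc n) (λ m → (G^ m) (suc n) * e m)
        ≈⟨ trans (×-distrib-∑ (suc n) (suc n) _) (∑-cong (suc n) (λ m → sym (×-assoc-* (suc n) _ _))) ⟩
      ∑ (suc n) (λ m → ∂ (G^ m) (suc n) * e m)
        ≈⟨ ∑-peel n _ ⟩
      ∂ δ (suc n) * e 0 + ∑ n (λ m → ∂ (G^ suc m) (suc n) * e (suc m))
        ≈⟨ +-cong (trans (*-congʳ (∂δ≈0 (suc n))) (zeroˡ _)) (∑-cong n (λ m → ∂G^suc-weighted m (suc n))) ⟩
      0# + ∑ n (λ m → (∂ G ⋆ G^ m) (suc n) * e m)
        ≈⟨ +-identityˡ _ ⟩
      ∑ n (λ m → ∑ (suc n) (λ i → ∂ G i * (G^ m) (suc n ∸ i)) * e m)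
        ≈⟨ ∑-cong n (λ m → trans (*-distribʳ-∑ (suc n) _ _) (∑-cong (suc n) (λ i → *-assoc _ _ _))) ⟩
      ∑ n (λ m → ∑ (suc n) (λ i → ∂ G i * ((G^ m) (suc n ∸ i) * e m)))
        ≈⟨ ∑-comm n (suc n) _ ⟩
      ∑ (suc n) (λ i → ∑ n (λ m → ∂ G i * ((G^ m) (suc n ∸ i) * e m)))
        ≈⟨ ∑-cong (suc n) (λ i → sym (*-distribˡ-∑ n _ _)) ⟩
      ∑ (suc n) (λ i → ∂ G i * ∑ n (λ m → (G^ m) (suc n ∸ i) * e m))
        ≈⟨ ∑-cong-≤ (suc n) truncate ⟩
      (∂ G ⋆ exp) (suc n) ∎
      where
      truncate : ∀ i → i ≤ suc n → ∂ G i * ∑ n (λ m → (G^ m) (suc n ∸ i) * e m) ≈ ∂ G i * exp (suc n ∸ i)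
      truncate zero _ = trans (zeroˡ _) (sym (zeroˡ _))
      truncate (suc i) _ = *-congˡ (exp-truncation (n ∸ i) n (ℕ.m∸n≤m n i))

module Permutations where

  open import Data.Nat as ℕ using (ℕ; zero; suc; _+_; _*_; _<_; _≤_; _<ᵇ_; _≡ᵇ_; z≤n; s≤s)
  import Data.Nat.Properties as ℕ
  open import Data.Nat.Tactic.RingSolver using (solve-∀)
  open import Data.Bool using (Bool; true; false; T; _∧_; _∨_; if_then_else_)
  open import Data.Bool.Properties using (∧-zeroʳ)
  open import Data.Unit using (tt)
  open import Data.List using (List; []; _∷_; map; concatMap; length; _++_)
  open import Data.List.Relation.Unary.All as All using (All; []; _∷_)
  open import Data.List.Relation.Unary.All.Properties using (map⁺; concat⁺)
  open import Data.Product using (_×_; _,_)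
  open import Data.Empty using (⊥-elim)
  open import Relation.Binary.Definitions using (tri<; tri≈; tri>)
  open import Relation.Binary.PropositionalEquality

  <ᵇ-true : ∀ {m n} → m < n → (m <ᵇ n) ≡ true
  <ᵇ-true {zero} {suc n} _ = refl
  <ᵇ-true {suc m} {suc n} (s≤s m<n) = <ᵇ-true m<n

  <ᵇ-false : ∀ {m n} → n ≤ m → (m <ᵇ n) ≡ false
  <ᵇ-false {m} {zero} _ = refl
  <ᵇ-false {suc m} {suc n} (s≤s n≤m) = <ᵇ-false n≤m

  count-map : ∀ {A B : Set} (p : B → Bool) (f : A → B) xs →
    count p (map f xs) ≡ count (λ x → p (f x)) xs
  count-map p f [] = refl
  count-map p f (x ∷ xs) = cong (_ +_) (count-map p f xs)

  count-++ : ∀ {A : Set} (p : A → Bool) xs ys → count p (xs ++ ys) ≡ count p xs + count p ys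
  count-++ p [] ys = refl
  count-++ p (x ∷ xs) ys =
    trans (cong (_ +_) (count-++ p xs ys)) (sym (ℕ.+-assoc (if p x then 1 else 0) _ _))

  monomial : ℕ → ℕ → ℕ
  monomial s k = if s ≡ᵇ k then 1 else 0

  monomial-scale : ∀ s k (g : ℕ → ℕ) → monomial s k * g s ≡ monomial s k * g k
  monomial-scale s k g with s ≡ᵇ k in s≡ᵇk
  ... | false = refl
  ... | true rewrite ℕ.≡ᵇ⇒≡ s k (subst T (sym s≡ᵇk) tt) = refl

  count-suc≡ᵇ0 : ∀ {A : Set} (f : A → ℕ) xs → count (λ x → suc (f x) ≡ᵇ 0) xs ≡ 0
  count-suc≡ᵇ0 f [] = refl
  count-suc≡ᵇ0 f (x ∷ xs) = count-suc≡ᵇ0 f xs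

  peakAt : ℕ → ℕ → ℕ → ℕ
  peakAt a b c = if (a <ᵇ b) ∧ (c <ᵇ b) then 1 else 0

  turnAt : ℕ → ℕ → ℕ → ℕ
  turnAt a b c = if ((a <ᵇ b) ∧ (c <ᵇ b)) ∨ ((b <ᵇ a) ∧ (b <ᵇ c)) then 1 else 0

  peakAt-peak : ∀ {a b c} → a < b → c < b → peakAt a b c ≡ 1
  peakAt-peak {a} {b} {c} a<b c<b rewrite <ᵇ-true a<b | <ᵇ-true c<b = refl

  peakAt-ascent : ∀ {a b c} → b < c → peakAt a b c ≡ 0
  peakAt-ascent {a} {b} {c} b<c rewrite <ᵇ-false {c} {b} (ℕ.<⇒≤ b<c) = cong (λ β → if β then 1 else 0) (∧-zeroʳ (a <ᵇ b))

  peakAt-descent : ∀ {a b c} → b < a → peakAt a b c ≡ 0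
  peakAt-descent {a} {b} b<a rewrite <ᵇ-false {a} {b} (ℕ.<⇒≤ b<a) = refl

  turnAt-rise : ∀ {a b c} → a < b → b < c → turnAt a b c ≡ 0
  turnAt-rise {a} {b} {c} a<b b<c
    rewrite <ᵇ-true a<b | <ᵇ-false {c} {b} (ℕ.<⇒≤ b<c) | <ᵇ-false {b} {a} (ℕ.<⇒≤ a<b) = refl

  turnAt-fall : ∀ {a b c} → b < a → c < b → turnAt a b c ≡ 0
  turnAt-fall {a} {b} {c} b<a c<b
    rewrite <ᵇ-false {a} {b} (ℕ.<⇒≤ b<a) | <ᵇ-false {b} {c} (ℕ.<⇒≤ c<b) | <ᵇ-true b<a = refl

  turnAt-peak : ∀ {a b c} → a < b → c < b → turnAt a b c ≡ 1
  turnAt-peak {a} {b} {c} a<b c<b rewrite <ᵇ-true a<b | <ᵇ-true c<b = refl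

  turnAt-valley : ∀ {a b c} → b < a → b < c → turnAt a b c ≡ 1
  turnAt-valley {a} {b} {c} b<a b<c
    rewrite <ᵇ-false {a} {b} (ℕ.<⇒≤ b<a) | <ᵇ-true b<a | <ᵇ-true b<c = refl

  peaksW-descent : ∀ {x c} w → c < x → peaksW (x ∷ c ∷ w) ≡ peaksW (c ∷ w)
  peaksW-descent [] _ = refl
  peaksW-descent (d ∷ w) c<x = cong (_+ peaksW (_ ∷ d ∷ w)) (peakAt-descent c<x)

  turnsW-descent : ∀ {x y c} w → c < x → c < y → turnsW (x ∷ c ∷ w) ≡ turnsW (y ∷ c ∷ w)
  turnsW-descent [] _ _ = refl
  turnsW-descent {x} {y} {c} (d ∷ w) c<x c<y
    rewrite <ᵇ-false {x} {c} (ℕ.<⇒≤ c<x) | <ᵇ-true c<x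
          | <ᵇ-false {y} {c} (ℕ.<⇒≤ c<y) | <ᵇ-true c<y = refl

  -- P k insertions of a new maximum give k peaks, in a word with p peaks and n letters after the
  -- first: the 2p + 1 slots next to a peak or at the end keep p, the other n - 2p slots give p + 1.
  PeakProfile : (ℕ → ℕ) → ℕ → ℕ → Set
  PeakProfile P p n =
    ∀ k → P k + monomial (suc p) k * (2 * p) ≡ monomial p k * suc (2 * p) + monomial (suc p) k * n

  peakProfile-flat : ∀ {P P′ q n} → PeakProfile P q n →
    (∀ k → P′ k ≡ monomial (suc q) k + P k) → PeakProfile P′ q (suc n)
  peakProfile-flat {P} {P′} {q} {n} profile P′≡ k = begin
    P′ k + m₁ * (2 * q)            ≡⟨ cong (_+ m₁ * (2 * q)) (P′≡ k) ⟩
    m₁ + P k + m₁ * (2 * q)        ≡⟨ ℕ.+-assoc m₁ (P k) _ ⟩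
    m₁ + (P k + m₁ * (2 * q))      ≡⟨ cong (m₁ +_) (profile k) ⟩
    m₁ + (m₀ * suc (2 * q) + m₁ * n) ≡⟨ arith m₀ m₁ q n ⟩
    m₀ * suc (2 * q) + m₁ * suc n  ∎
    where
    open ≡-Reasoning
    m₀ = monomial q k
    m₁ = monomial (suc q) k
    arith : ∀ m₀ m₁ q n → m₁ + (m₀ * suc (2 * q) + m₁ * n) ≡ m₀ * suc (2 * q) + m₁ * suc n
    arith = solve-∀

  peakProfile-peak : ∀ {P P′ q n} → PeakProfile P q n → P′ 0 ≡ 0 →
    (∀ j → P′ (suc j) + monomial (suc q) j ≡ 2 * monomial q j + P j) →
    PeakProfile P′ (suc q) (suc n)
  peakProfile-peak profile P′0≡0 P′≡ zero = cong (_+ 0) P′0≡0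
  peakProfile-peak {P} {P′} {q} {n} profile P′0≡0 P′≡ (suc j) = ℕ.+-cancelʳ-≡ (P j) _ _ (begin
    P′ (suc j) + m₁ * (2 * suc q) + P j            ≡⟨ arith₁ (P′ (suc j)) (P j) m₁ q ⟩
    (P′ (suc j) + m₁) + (P j + m₁ * (2 * q)) + m₁  ≡⟨ cong₂ (λ x y → x + y + m₁) (P′≡ j) (profile j) ⟩
    (2 * m₀ + P j) + (m₀ * suc (2 * q) + m₁ * n) + m₁ ≡⟨ arith₂ (P j) m₀ m₁ q n ⟩
    m₀ * suc (2 * suc q) + m₁ * suc n + P j        ∎)
    where
    open ≡-Reasoning
    m₀ = monomial q j
    m₁ = monomial (suc q) j
    arith₁ : ∀ x p m₁ q → x + m₁ * (2 * suc q) + p ≡ (x + m₁) + (p + m₁ * (2 * q)) + m₁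
    arith₁ = solve-∀
    arith₂ : ∀ p m₀ m₁ q n → (2 * m₀ + p) + (m₀ * suc (2 * q) + m₁ * n) + m₁ ≡ m₀ * suc (2 * suc q) + m₁ * suc n + p
    arith₂ = solve-∀

  -- Inserting a new maximum into a word with t turns gives t, t + 1 or t + 2 turns; the counts of the
  -- first two depend on whether the word starts with an ascent.
  turnStart : Bool → ℕ → ℕ → ℕ
  turnStart true t k = monomial t k * suc t + monomial (suc t) k
  turnStart false t k = monomial t k * t + monomial (suc t) k * 2

  TurnProfile : Bool → (ℕ → ℕ) → ℕ → ℕ → Set
  TurnProfile up P t n =
    ∀ k → P k + monomial (suc (suc t)) k * suc t ≡ turnStart up t k + monomial (suc (suc t)) k * n

  turnProfile-flat : ∀ {up P P′ q n} → TurnProfile up P q n →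
    (∀ k → P′ k ≡ monomial (suc (suc q)) k + P k) → TurnProfile up P′ q (suc n)
  turnProfile-flat {up} {P} {P′} {q} {n} profile P′≡ k = begin
    P′ k + m₂ * suc q                  ≡⟨ cong (_+ m₂ * suc q) (P′≡ k) ⟩
    m₂ + P k + m₂ * suc q              ≡⟨ ℕ.+-assoc m₂ (P k) _ ⟩
    m₂ + (P k + m₂ * suc q)            ≡⟨ cong (m₂ +_) (profile k) ⟩
    m₂ + (turnStart up q k + m₂ * n)   ≡⟨ arith m₂ (turnStart up q k) n ⟩
    turnStart up q k + m₂ * suc n      ∎
    where
    open ≡-Reasoning
    m₂ = monomial (suc (suc q)) k
    arith : ∀ m₂ s n → m₂ + (s + m₂ * n) ≡ s + m₂ * suc n
    arith = solve-∀

  turnProfile-peak : ∀ {P P′ q n} → TurnProfile false P q n → P′ 0 ≡ 0 →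
    (∀ j → P′ (suc j) + monomial (suc q) j ≡ 2 * monomial q j + P j) →
    TurnProfile true P′ (suc q) (suc n)
  turnProfile-peak profile P′0≡0 P′≡ zero = cong (_+ 0) P′0≡0
  turnProfile-peak {P} {P′} {q} {n} profile P′0≡0 P′≡ (suc j) = ℕ.+-cancelʳ-≡ (P j + m₁) _ _ (begin
    P′ (suc j) + m₂ * suc (suc q) + (P j + m₁)       ≡⟨ arith₁ (P′ (suc j)) (P j) m₁ m₂ q ⟩
    (P′ (suc j) + m₁) + (P j + m₂ * suc q) + m₂      ≡⟨ cong₂ (λ x y → x + y + m₂) (P′≡ j) (profile j) ⟩
    (2 * m₀ + P j) + (m₀ * q + m₁ * 2 + m₂ * n) + m₂ ≡⟨ arith₂ (P j) m₀ m₁ m₂ q n ⟩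
    m₀ * suc (suc q) + m₁ + m₂ * suc n + (P j + m₁)  ∎)
    where
    open ≡-Reasoning
    m₀ = monomial q j
    m₁ = monomial (suc q) j
    m₂ = monomial (suc (suc q)) j
    arith₁ : ∀ x p m₁ m₂ q → x + m₂ * suc (suc q) + (p + m₁) ≡ (x + m₁) + (p + m₂ * suc q) + m₂
    arith₁ = solve-∀
    arith₂ : ∀ p m₀ m₁ m₂ q n →
      (2 * m₀ + p) + (m₀ * q + m₁ * 2 + m₂ * n) + m₂ ≡ m₀ * suc (suc q) + m₁ + m₂ * suc n + (p + m₁)
    arith₂ = solve-∀

  turnProfile-valley : ∀ {P P′ q n} → TurnProfile true P q n → P′ 0 ≡ 0 →
    (∀ j → P′ (suc j) ≡ monomial (suc q) j + P j) → TurnProfile false P′ (suc q) (suc n)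
  turnProfile-valley profile P′0≡0 P′≡ zero = cong (_+ 0) P′0≡0
  turnProfile-valley {P} {P′} {q} {n} profile P′0≡0 P′≡ (suc j) = begin
    P′ (suc j) + m₂ * suc (suc q)              ≡⟨ cong (_+ m₂ * suc (suc q)) (P′≡ j) ⟩
    m₁ + P j + m₂ * suc (suc q)                ≡⟨ arith₁ (P j) m₁ m₂ q ⟩
    m₁ + m₂ + (P j + m₂ * suc q)               ≡⟨ cong (m₁ + m₂ +_) (profile j) ⟩
    m₁ + m₂ + (m₀ * suc q + m₁ + m₂ * n)       ≡⟨ arith₂ m₀ m₁ m₂ q n ⟩
    m₀ * suc q + m₁ * 2 + m₂ * suc n           ∎
    where
    open ≡-Reasoning
    m₀ = monomial q j
    m₁ = monomial (suc q) j
    m₂ = monomial (suc (suc q)) j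
    arith₁ : ∀ p m₁ m₂ q → m₁ + p + m₂ * suc (suc q) ≡ m₁ + m₂ + (p + m₂ * suc q)
    arith₁ = solve-∀
    arith₂ : ∀ m₀ m₁ m₂ q n → m₁ + m₂ + (m₀ * suc q + m₁ + m₂ * n) ≡ m₀ * suc q + m₁ * 2 + m₂ * suc n
    arith₂ = solve-∀

  data Admissible (M : ℕ) : List ℕ → Set where
    single : ∀ {a} → a < M → Admissible M (a ∷ [])
    cons   : ∀ {a b w} → a < M → a ≢ b → Admissible M (b ∷ w) → Admissible M (a ∷ b ∷ w)

  head<M : ∀ {M a w} → Admissible M (a ∷ w) → a < M
  head<M (single a<M) = a<M
  head<M (cons a<M _ _) = a<M

  module Insertion (M : ℕ) where

    insertionCount : (List ℕ → ℕ) → List ℕ → ℕ → ℕ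
    insertionCount s v k = count (λ u → s u ≡ᵇ k) (insertEverywhere M v)

    insertionCount-∷ : ∀ s b v k →
      insertionCount s (b ∷ v) k ≡ monomial (s (M ∷ b ∷ v)) k + insertionCount (λ u → s (b ∷ u)) v k
    insertionCount-∷ s b v k = cong (monomial (s (M ∷ b ∷ v)) k +_)
      (count-map (λ u → s u ≡ᵇ k) (b ∷_) (insertEverywhere M v))

    insertionCount-∷∷ : ∀ s b c v k → insertionCount s (b ∷ c ∷ v) k ≡
      monomial (s (M ∷ b ∷ c ∷ v)) k + (monomial (s (b ∷ M ∷ c ∷ v)) k + insertionCount (λ u → s (b ∷ c ∷ u)) v k)
    insertionCount-∷∷ s b c v k = trans (insertionCount-∷ s b (c ∷ v) k)
      (cong (monomial (s (M ∷ b ∷ c ∷ v)) k +_) (insertionCount-∷ (λ u → s (b ∷ u)) c v k))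

    PeakLaw : ℕ → List ℕ → Set
    PeakLaw a v = PeakProfile (insertionCount (λ u → peaksW (a ∷ u)) v) (peaksW (a ∷ v)) (length v)

    module PeakStep (a b c : ℕ) (v : List ℕ) (a<M : a < M) (b<M : b < M) (c<M : c < M) where

      private
        q = peaksW (b ∷ c ∷ v)
        s₁ = peaksW (b ∷ M ∷ c ∷ v)
        Pa = insertionCount (λ u → peaksW (a ∷ u)) (b ∷ c ∷ v)
        Pb = insertionCount (λ u → peaksW (b ∷ u)) (c ∷ v)
        C : ℕ → ℕ → ℕ
        C e k = count (λ u → (e + peaksW (b ∷ c ∷ u)) ≡ᵇ k) (insertEverywhere M v)

        peakCount-∷∷ : ∀ k → Pa k ≡ monomial (suc q) k + (monomial s₁ k + C (peakAt a b c) k)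
        peakCount-∷∷ k = trans (insertionCount-∷∷ (λ u → peaksW (a ∷ u)) b c v k)
          (cong₂ (λ x y → monomial x k + (monomial y k + C (peakAt a b c) k))
            (cong₂ _+_ (peakAt-peak a<M b<M) (cong (_+ q) (peakAt-descent b<M)))
            (cong (_+ s₁) (peakAt-ascent b<M)))

        Pb≡ : ∀ k → Pb k ≡ monomial s₁ k + C 0 k
        Pb≡ = insertionCount-∷ (λ u → peaksW (b ∷ u)) c v

      flat : peakAt a b c ≡ 0 → PeakLaw b (c ∷ v) → PeakLaw a (b ∷ c ∷ v)
      flat noPeak law = subst (λ p → PeakProfile Pa p (length (b ∷ c ∷ v))) (sym (cong (_+ q) noPeak))
        (peakProfile-flat law (λ k → trans (peakCount-∷∷ k) (trans
          (cong (λ e → monomial (suc q) k + (monomial s₁ k + C e k)) noPeak)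
          (cong (monomial (suc q) k +_) (sym (Pb≡ k))))))

      peak : a < b → c < b → PeakLaw b (c ∷ v) → PeakLaw a (b ∷ c ∷ v)
      peak a<b c<b law = subst (λ p → PeakProfile Pa p (length (b ∷ c ∷ v))) (sym (cong (_+ q) (peakAt-peak a<b c<b)))
        (peakProfile-peak law Pa0≡0 Pa≡)
        where
        s₁≡ : s₁ ≡ suc q
        s₁≡ = cong₂ _+_ (peakAt-peak b<M c<M) (trans (peaksW-descent v c<M) (sym (peaksW-descent v c<b)))
        Pa′≡ : ∀ k → Pa k ≡ monomial (suc q) k + (monomial (suc q) k + C 1 k)
        Pa′≡ k = trans (peakCount-∷∷ k)
          (cong₂ (λ s e → monomial (suc q) k + (monomial s k + C e k)) s₁≡ (peakAt-peak a<b c<b))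
        Pa0≡0 : Pa 0 ≡ 0
        Pa0≡0 = trans (Pa′≡ 0) (count-suc≡ᵇ0 (λ u → peaksW (b ∷ c ∷ u)) (insertEverywhere M v))
        Pa≡ : ∀ j → Pa (suc j) + monomial (suc q) j ≡ 2 * monomial q j + Pb j
        Pa≡ j = begin
          Pa (suc j) + monomial (suc q) j                   ≡⟨ cong (_+ monomial (suc q) j) (Pa′≡ (suc j)) ⟩
          monomial q j + (monomial q j + C 0 j) + monomial (suc q) j ≡⟨ arith (monomial q j) (monomial (suc q) j) (C 0 j) ⟩
          2 * monomial q j + (monomial (suc q) j + C 0 j)   ≡⟨ cong (λ s → 2 * monomial q j + (monomial s j + C 0 j)) s₁≡ ⟨
          2 * monomial q j + (monomial s₁ j + C 0 j)        ≡⟨ cong (2 * monomial q j +_) (Pb≡ j) ⟨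
          2 * monomial q j + Pb j                           ∎
          where
          open ≡-Reasoning
          arith : ∀ m₀ m₁ c → m₀ + (m₀ + c) + m₁ ≡ 2 * m₀ + (m₁ + c)
          arith = solve-∀

    peakLaw : ∀ a v → Admissible M (a ∷ v) → PeakLaw a v
    peakLaw a [] (single a<M) k = arith (monomial 0 k) (monomial 1 k)
      where
      arith : ∀ m₀ m₁ → m₀ + 0 + m₁ * 0 ≡ m₀ * 1 + m₁ * 0
      arith = solve-∀
    peakLaw a (b ∷ []) (cons a<M _ (single b<M)) k
      rewrite peakAt-peak {c = b} a<M b<M | peakAt-ascent {a} b<M = arith (monomial 0 k) (monomial 1 k)
      where
      arith : ∀ m₀ m₁ → m₁ + (m₀ + 0) + m₁ * 0 ≡ m₀ * 1 + m₁ * 1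
      arith = solve-∀
    peakLaw a (b ∷ c ∷ v) (cons a<M a≢b wb@(cons b<M b≢c wc))
      with ℕ.<-cmp a b | ℕ.<-cmp b c | peakLaw b (c ∷ v) wb
    ... | tri≈ _ a≡b _ | _ | _ = ⊥-elim (a≢b a≡b)
    ... | _ | tri≈ _ b≡c _ | _ = ⊥-elim (b≢c b≡c)
    ... | tri> _ _ b<a | _ | law = PeakStep.flat a b c v a<M b<M (head<M wc) (peakAt-descent b<a) law
    ... | tri< _ _ _ | tri< b<c _ _ | law = PeakStep.flat a b c v a<M b<M (head<M wc) (peakAt-ascent b<c) law
    ... | tri< a<b _ _ | tri> _ _ c<b | law = PeakStep.peak a b c v a<M b<M (head<M wc) a<b c<b law

    TurnLaw : ℕ → ℕ → List ℕ → Set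
    TurnLaw a b v = TurnProfile (a <ᵇ b) (insertionCount (λ u → turnsW (a ∷ u)) (b ∷ v))
                      (turnsW (a ∷ b ∷ v)) (length (b ∷ v))

    module TurnStep (a b c : ℕ) (v : List ℕ) (a<M : a < M) (b<M : b < M) (c<M : c < M) where

      private
        q = turnsW (b ∷ c ∷ v)
        s₁ = turnsW (b ∷ M ∷ c ∷ v)
        n = length (c ∷ v)
        Pa = insertionCount (λ u → turnsW (a ∷ u)) (b ∷ c ∷ v)
        Pb = insertionCount (λ u → turnsW (b ∷ u)) (c ∷ v)
        C : ℕ → ℕ → ℕ
        C e k = count (λ u → (e + turnsW (b ∷ c ∷ u)) ≡ᵇ k) (insertEverywhere M v)

        turnCount-∷∷ : ∀ k → Pa k ≡ monomial (suc (turnAt M b c + q)) k + (monomial (turnAt a b M + s₁) k + C (turnAt a b c) k)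
        turnCount-∷∷ k = trans (insertionCount-∷∷ (λ u → turnsW (a ∷ u)) b c v k)
          (cong (λ t → monomial (t + (turnAt M b c + q)) k + (monomial (turnAt a b M + s₁) k + C (turnAt a b c) k)) (turnAt-peak a<M b<M))

        Pb≡ : ∀ k → Pb k ≡ monomial s₁ k + C 0 k
        Pb≡ = insertionCount-∷ (λ u → turnsW (b ∷ u)) c v

        s₁≡ : c < b → s₁ ≡ suc q
        s₁≡ c<b = cong₂ _+_ (turnAt-peak b<M c<M) (turnsW-descent v c<M c<b)

        conclude : ∀ {up t} → (a <ᵇ b) ≡ up → turnAt a b c ≡ t →
          TurnProfile up Pa (t + q) (suc n) → TurnLaw a b (c ∷ v)
        conclude ab≡ turn≡ = subst₂ (λ up t → TurnProfile up Pa t (suc n)) (sym ab≡) (sym (cong (_+ q) turn≡))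

        premise : ∀ {up} → (b <ᵇ c) ≡ up → TurnLaw b c v → TurnProfile up Pb q n
        premise bc≡ = subst (λ up → TurnProfile up Pb q n) bc≡

        turnCount : ∀ {x y e} → turnAt M b c ≡ x → turnAt a b M ≡ y → turnAt a b c ≡ e →
          ∀ k → Pa k ≡ monomial (suc (x + q)) k + (monomial (y + s₁) k + C e k)
        turnCount refl refl refl = turnCount-∷∷

        C1-zero : C 1 0 ≡ 0
        C1-zero = count-suc≡ᵇ0 (λ u → turnsW (b ∷ c ∷ u)) (insertEverywhere M v)

      rise : a < b → b < c → TurnLaw b c v → TurnLaw a b (c ∷ v)
      rise a<b b<c law = conclude (<ᵇ-true a<b) abc≡
        (turnProfile-flat {up = true} (premise (<ᵇ-true b<c) law) (λ k →
          trans (turnCount (turnAt-valley b<M b<c) (turnAt-rise a<b b<M) abc≡ k)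
                (cong (monomial (suc (suc q)) k +_) (sym (Pb≡ k)))))
        where
        abc≡ : turnAt a b c ≡ 0
        abc≡ = turnAt-rise a<b b<c

      fall : b < a → c < b → TurnLaw b c v → TurnLaw a b (c ∷ v)
      fall b<a c<b law = conclude (<ᵇ-false (ℕ.<⇒≤ b<a)) abc≡
        (turnProfile-flat {up = false} (premise (<ᵇ-false (ℕ.<⇒≤ c<b)) law) (λ k → begin
          Pa k                                                        ≡⟨ turnCount (turnAt-fall b<M c<b) (turnAt-valley b<a b<M) abc≡ k ⟩
          monomial (suc q) k + (monomial (suc s₁) k + C 0 k)
            ≡⟨ cong (λ s → monomial (suc q) k + (monomial (suc s) k + C 0 k)) (s₁≡ c<b) ⟩
          monomial (suc q) k + (monomial (suc (suc q)) k + C 0 k)     ≡⟨ arith (monomial (suc q) k) (monomial (suc (suc q)) k) (C 0 k) ⟩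
          monomial (suc (suc q)) k + (monomial (suc q) k + C 0 k)
            ≡⟨ cong (λ s → monomial (suc (suc q)) k + (monomial s k + C 0 k)) (s₁≡ c<b) ⟨
          monomial (suc (suc q)) k + (monomial s₁ k + C 0 k)          ≡⟨ cong (monomial (suc (suc q)) k +_) (Pb≡ k) ⟨
          monomial (suc (suc q)) k + Pb k                             ∎))
        where
        open ≡-Reasoning
        abc≡ : turnAt a b c ≡ 0
        abc≡ = turnAt-fall b<a c<b
        arith : ∀ x y z → x + (y + z) ≡ y + (x + z)
        arith = solve-∀

      peak : a < b → c < b → TurnLaw b c v → TurnLaw a b (c ∷ v)
      peak a<b c<b law = conclude (<ᵇ-true a<b) abc≡
        (turnProfile-peak (premise (<ᵇ-false (ℕ.<⇒≤ c<b)) law) (trans (Pa≡ 0) C1-zero) (λ j → begin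
          Pa (suc j) + monomial (suc q) j                       ≡⟨ cong (_+ monomial (suc q) j) (Pa≡ (suc j)) ⟩
          monomial q j + (monomial q j + C 0 j) + monomial (suc q) j ≡⟨ arith (monomial q j) (monomial (suc q) j) (C 0 j) ⟩
          2 * monomial q j + (monomial (suc q) j + C 0 j)       ≡⟨ cong (λ s → 2 * monomial q j + (monomial s j + C 0 j)) (s₁≡ c<b) ⟨
          2 * monomial q j + (monomial s₁ j + C 0 j)            ≡⟨ cong (2 * monomial q j +_) (Pb≡ j) ⟨
          2 * monomial q j + Pb j                               ∎))
        where
        open ≡-Reasoning
        abc≡ : turnAt a b c ≡ 1
        abc≡ = turnAt-peak a<b c<b
        Pa≡ : ∀ k → Pa k ≡ monomial (suc q) k + (monomial (suc q) k + C 1 k)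
        Pa≡ k = trans (turnCount (turnAt-fall b<M c<b) (turnAt-rise a<b b<M) abc≡ k)
          (cong (λ s → monomial (suc q) k + (monomial s k + C 1 k)) (s₁≡ c<b))
        arith : ∀ m₀ m₁ c → m₀ + (m₀ + c) + m₁ ≡ 2 * m₀ + (m₁ + c)
        arith = solve-∀

      valley : b < a → b < c → TurnLaw b c v → TurnLaw a b (c ∷ v)
      valley b<a b<c law = conclude (<ᵇ-false (ℕ.<⇒≤ b<a)) abc≡
        (turnProfile-valley (premise (<ᵇ-true b<c) law) (trans (Pa≡ 0) C1-zero) (λ j →
          trans (Pa≡ (suc j)) (cong (monomial (suc q) j +_) (sym (Pb≡ j)))))
        where
        abc≡ : turnAt a b c ≡ 1
        abc≡ = turnAt-valley b<a b<c
        Pa≡ : ∀ k → Pa k ≡ monomial (suc (suc q)) k + (monomial (suc s₁) k + C 1 k)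
        Pa≡ = turnCount (turnAt-valley b<M b<c) (turnAt-valley b<a b<M) abc≡

    turnLaw : ∀ a b v → Admissible M (a ∷ b ∷ v) → TurnLaw a b v
    turnLaw a b [] (cons a<M a≢b (single b<M)) with ℕ.<-cmp a b
    ... | tri≈ _ a≡b _ = ⊥-elim (a≢b a≡b)
    ... | tri< a<b _ _ = λ k → begin
      P k + monomial 2 k * 1                  ≡⟨ cong₂ (λ x y → monomial (x + 0) k + (monomial (y + 0) k + 0) + monomial 2 k * 1)
                                                    (turnAt-peak a<M b<M) (turnAt-rise a<b b<M) ⟩
      monomial 1 k + (monomial 0 k + 0) + monomial 2 k * 1  ≡⟨ arith (monomial 0 k) (monomial 1 k) (monomial 2 k) ⟩
      turnStart true 0 k + monomial 2 k * 1   ≡⟨ cong (λ up → turnStart up 0 k + monomial 2 k * 1) (<ᵇ-true a<b) ⟨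
      turnStart (a <ᵇ b) 0 k + monomial 2 k * 1 ∎
      where
      open ≡-Reasoning
      P = insertionCount (λ u → turnsW (a ∷ u)) (b ∷ [])
      arith : ∀ m₀ m₁ m₂ → m₁ + (m₀ + 0) + m₂ * 1 ≡ m₀ * 1 + m₁ + m₂ * 1
      arith = solve-∀
    ... | tri> _ _ b<a = λ k → begin
      P k + monomial 2 k * 1                  ≡⟨ cong₂ (λ x y → monomial (x + 0) k + (monomial (y + 0) k + 0) + monomial 2 k * 1)
                                                    (turnAt-peak a<M b<M) (turnAt-valley b<a b<M) ⟩
      monomial 1 k + (monomial 1 k + 0) + monomial 2 k * 1  ≡⟨ arith (monomial 0 k) (monomial 1 k) (monomial 2 k) ⟩
      turnStart false 0 k + monomial 2 k * 1  ≡⟨ cong (λ up → turnStart up 0 k + monomial 2 k * 1) (<ᵇ-false (ℕ.<⇒≤ b<a)) ⟨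
      turnStart (a <ᵇ b) 0 k + monomial 2 k * 1 ∎
      where
      open ≡-Reasoning
      P = insertionCount (λ u → turnsW (a ∷ u)) (b ∷ [])
      arith : ∀ m₀ m₁ m₂ → m₁ + (m₁ + 0) + m₂ * 1 ≡ m₀ * 0 + m₁ * 2 + m₂ * 1
      arith = solve-∀
    turnLaw a b (c ∷ v) (cons a<M a≢b wb@(cons b<M b≢c wc))
      with ℕ.<-cmp a b | ℕ.<-cmp b c | turnLaw b c v wb
    ... | tri≈ _ a≡b _ | _ | _ = ⊥-elim (a≢b a≡b)
    ... | _ | tri≈ _ b≡c _ | _ = ⊥-elim (b≢c b≡c)
    ... | tri< a<b _ _ | tri< b<c _ _ | law = TurnStep.rise a b c v a<M b<M (head<M wc) a<b b<c law
    ... | tri> _ _ b<a | tri> _ _ c<b | law = TurnStep.fall a b c v a<M b<M (head<M wc) b<a c<b law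
    ... | tri< a<b _ _ | tri> _ _ c<b | law = TurnStep.peak a b c v a<M b<M (head<M wc) a<b c<b law
    ... | tri> _ _ b<a | tri< b<c _ _ | law = TurnStep.valley a b c v a<M b<M (head<M wc) b<a b<c law

  admissible-weaken : ∀ {M w} → Admissible M w → Admissible (suc M) w
  admissible-weaken (single a<M) = single (ℕ.m<n⇒m<1+n a<M)
  admissible-weaken (cons a<M a≢b w) = cons (ℕ.m<n⇒m<1+n a<M) a≢b (admissible-weaken w)

  insert-admissible : ∀ {M a} σ → Admissible M (a ∷ σ) →
    All (λ τ → Admissible (suc M) (a ∷ τ)) (insertEverywhere M σ)
  insert-admissible [] (single a<M) =
    cons (ℕ.m<n⇒m<1+n a<M) (ℕ.<⇒≢ a<M) (single ℕ.≤-refl) ∷ []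
  insert-admissible (b ∷ σ) (cons a<M a≢b wb) =
    cons (ℕ.m<n⇒m<1+n a<M) (ℕ.<⇒≢ a<M) (cons ℕ.≤-refl (ℕ.>⇒≢ (head<M wb)) (admissible-weaken wb))
    ∷ map⁺ (All.map (cons (ℕ.m<n⇒m<1+n a<M) a≢b) (insert-admissible σ wb))

  insert-length : ∀ M σ → All (λ τ → length τ ≡ suc (length σ)) (insertEverywhere M σ)
  insert-length M [] = refl ∷ []
  insert-length M (b ∷ σ) = refl ∷ map⁺ (All.map (cong suc) (insert-length M σ))

  PermWord : ℕ → List ℕ → Set
  PermWord n σ = Admissible (suc n) (0 ∷ σ) × length σ ≡ n

  perms-permWord : ∀ n → All (PermWord n) (perms n)
  perms-permWord zero = (single (s≤s z≤n) , refl) ∷ []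
  perms-permWord (suc n) = concat⁺ (map⁺ (All.map insertion (perms-permWord n)))
    where
    insertion : ∀ {σ} → PermWord n σ → All (PermWord (suc n)) (insertEverywhere (suc n) σ)
    insertion {σ} (adm , len) = All.zipWith (λ (adm′ , len′) → adm′ , trans len′ (cong suc len))
      (insert-admissible σ adm , insert-length (suc n) σ)

  add-identities : ∀ a b c d a′ b′ c′ d′ x y z →
    a + b * x ≡ c * y + d * z → a′ + b′ * x ≡ c′ * y + d′ * z →
    (a + a′) + (b + b′) * x ≡ (c + c′) * y + (d + d′) * z
  add-identities a b c d a′ b′ c′ d′ x y z e e′ = begin
    (a + a′) + (b + b′) * x                ≡⟨ arith₁ a b a′ b′ x ⟩
    (a + b * x) + (a′ + b′ * x)            ≡⟨ cong₂ _+_ e e′ ⟩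
    (c * y + d * z) + (c′ * y + d′ * z)    ≡⟨ arith₂ c d c′ d′ y z ⟩
    (c + c′) * y + (d + d′) * z            ∎
    where
    open ≡-Reasoning
    arith₁ : ∀ a b a′ b′ x → (a + a′) + (b + b′) * x ≡ (a + b * x) + (a′ + b′ * x)
    arith₁ = solve-∀
    arith₂ : ∀ c d c′ d′ y z → (c * y + d * z) + (c′ * y + d′ * z) ≡ (c + c′) * y + (d + d′) * z
    arith₂ = solve-∀

  add-identities₃ : ∀ a b c d e a′ b′ c′ d′ e′ x y z →
    a + b * x ≡ c * y + d + e * z → a′ + b′ * x ≡ c′ * y + d′ + e′ * z →
    (a + a′) + (b + b′) * x ≡ (c + c′) * y + (d + d′) + (e + e′) * z
  add-identities₃ a b c d e a′ b′ c′ d′ e′ x y z h h′ = begin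
    (a + a′) + (b + b′) * x                        ≡⟨ arith₁ a b a′ b′ x ⟩
    (a + b * x) + (a′ + b′ * x)                    ≡⟨ cong₂ _+_ h h′ ⟩
    (c * y + d + e * z) + (c′ * y + d′ + e′ * z)   ≡⟨ arith₂ c d e c′ d′ e′ y z ⟩
    (c + c′) * y + (d + d′) + (e + e′) * z         ∎
    where
    open ≡-Reasoning
    arith₁ : ∀ a b a′ b′ x → (a + a′) + (b + b′) * x ≡ (a + b * x) + (a′ + b′ * x)
    arith₁ = solve-∀
    arith₂ : ∀ c d e c′ d′ e′ y z →
      (c * y + d + e * z) + (c′ * y + d′ + e′ * z) ≡ (c + c′) * y + (d + d′) + (e + e′) * z
    arith₂ = solve-∀

  countBy : (List ℕ → ℕ) → List (List ℕ) → ℕ → ℕ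
  countBy s S k = count (λ σ → s σ ≡ᵇ k) S

  countBy-concatMap : ∀ s (f : List ℕ → List (List ℕ)) σ S k →
    countBy s (concatMap f (σ ∷ S)) k ≡ countBy s (f σ) k + countBy s (concatMap f S) k
  countBy-concatMap s f σ S k = count-++ (λ τ → s τ ≡ᵇ k) (f σ) (concatMap f S)

  module _ {n : ℕ} where

    leftPeakLaw : ∀ {σ} → PermWord n σ → ∀ j →
      countBy leftPeaks (insertEverywhere (suc n) σ) (suc j) + monomial (leftPeaks σ) j * (2 * j)
      ≡ monomial (leftPeaks σ) (suc j) * suc (2 * suc j) + monomial (leftPeaks σ) j * n
    leftPeakLaw {σ} (adm , len) j = begin
      P (suc j) + m j * (2 * j)                 ≡⟨ cong (P (suc j) +_) (monomial-scale p j (2 *_)) ⟨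
      P (suc j) + m j * (2 * p)                 ≡⟨ Insertion.peakLaw (suc n) 0 σ adm (suc j) ⟩
      m (suc j) * suc (2 * p) + m j * length σ
        ≡⟨ cong₂ (λ x y → x + m j * y) (monomial-scale p (suc j) (λ x → suc (2 * x))) len ⟩
      m (suc j) * suc (2 * suc j) + m j * n     ∎
      where
      open ≡-Reasoning
      P = countBy leftPeaks (insertEverywhere (suc n) σ)
      p = leftPeaks σ
      m = monomial p

    leftPeakLaw₀ : ∀ {σ} → PermWord n σ → countBy leftPeaks (insertEverywhere (suc n) σ) 0 ≡ monomial (leftPeaks σ) 0
    leftPeakLaw₀ {σ} (adm , _) = begin
      countBy leftPeaks (insertEverywhere (suc n) σ) 0                    ≡⟨ ℕ.+-identityʳ _ ⟨
      countBy leftPeaks (insertEverywhere (suc n) σ) 0 + 0                ≡⟨ Insertion.peakLaw (suc n) 0 σ adm 0 ⟩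
      monomial p 0 * suc (2 * p) + 0                 ≡⟨ cong (_+ 0) (monomial-scale p 0 (λ x → suc (2 * x))) ⟩
      monomial p 0 * 1 + 0                           ≡⟨ arith (monomial p 0) ⟩
      monomial p 0                                   ∎
      where
      open ≡-Reasoning
      p = leftPeaks σ
      arith : ∀ m → m * 1 + 0 ≡ m
      arith = solve-∀

    L-recurrence-on : ∀ S → All (PermWord n) S → ∀ j →
      countBy leftPeaks (concatMap (insertEverywhere (suc n)) S) (suc j) + countBy leftPeaks S j * (2 * j)
      ≡ countBy leftPeaks S (suc j) * suc (2 * suc j) + countBy leftPeaks S j * n
    L-recurrence-on [] [] j = refl
    L-recurrence-on (σ ∷ S) (w ∷ ws) j =
      trans (cong (_+ countBy leftPeaks (σ ∷ S) j * (2 * j)) (countBy-concatMap leftPeaks (insertEverywhere (suc n)) σ S (suc j)))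
            (add-identities (countBy leftPeaks (insertEverywhere (suc n) σ) (suc j)) (m j) (m (suc j)) (m j)
                            (countBy leftPeaks (concatMap (insertEverywhere (suc n)) S) (suc j))
                            (countBy leftPeaks S j) (countBy leftPeaks S (suc j)) (countBy leftPeaks S j)
                            (2 * j) (suc (2 * suc j)) n (leftPeakLaw w j) (L-recurrence-on S ws j))
      where m = monomial (leftPeaks σ)

    L-recurrence₀-on : ∀ S → All (PermWord n) S → countBy leftPeaks (concatMap (insertEverywhere (suc n)) S) 0 ≡ countBy leftPeaks S 0
    L-recurrence₀-on [] [] = refl
    L-recurrence₀-on (σ ∷ S) (w ∷ ws) =
      trans (countBy-concatMap leftPeaks (insertEverywhere (suc n)) σ S 0) (cong₂ _+_ (leftPeakLaw₀ w) (L-recurrence₀-on S ws))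

  L-recurrence : ∀ n j → L (suc n) (suc j) + L n j * (2 * j) ≡ L n (suc j) * suc (2 * suc j) + L n j * n
  L-recurrence n = L-recurrence-on {n} (perms n) (perms-permWord n)

  L-recurrence₀ : ∀ n → L (suc n) 0 ≡ L n 0
  L-recurrence₀ n = L-recurrence₀-on {n} (perms n) (perms-permWord n)

  module _ {m : ℕ} where

    udRunLaw : ∀ {σ} → PermWord (suc m) σ → ∀ j →
      countBy udRuns (insertEverywhere (suc (suc m)) σ) (suc (suc j)) + monomial (udRuns σ) j * j
      ≡ monomial (udRuns σ) (suc (suc j)) * suc (suc j) + monomial (udRuns σ) (suc j) + monomial (udRuns σ) j * suc m
    udRunLaw {zero ∷ v} (cons _ 0≢0 _ , _) j = ⊥-elim (0≢0 refl)
    udRunLaw {σ@(suc b ∷ v)} (adm , len) j = begin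
      P (suc j) + r j * j                              ≡⟨ cong (P (suc j) +_) (monomial-scale u j (λ x → x)) ⟨
      P (suc j) + r j * u                              ≡⟨ Insertion.turnLaw (suc (suc m)) 0 (suc b) v adm (suc j) ⟩
      r (suc (suc j)) * u + r (suc j) + r j * length σ
        ≡⟨ cong₂ (λ x y → x + r (suc j) + r j * y) (monomial-scale u (suc (suc j)) (λ x → x)) len ⟩
      r (suc (suc j)) * suc (suc j) + r (suc j) + r j * suc m ∎
      where
      open ≡-Reasoning
      P = Insertion.insertionCount (suc (suc m)) (λ τ → turnsW (0 ∷ τ)) σ
      u = udRuns σ
      r = monomial u

    udRunLaw₁ : ∀ {σ} → PermWord (suc m) σ →
      countBy udRuns (insertEverywhere (suc (suc m)) σ) 1 ≡ monomial (udRuns σ) 1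
    udRunLaw₁ {zero ∷ v} (cons _ 0≢0 _ , _) = ⊥-elim (0≢0 refl)
    udRunLaw₁ {σ@(suc b ∷ v)} (adm , _) = begin
      P 0                            ≡⟨ ℕ.+-identityʳ _ ⟨
      P 0 + 0                        ≡⟨ Insertion.turnLaw (suc (suc m)) 0 (suc b) v adm 0 ⟩
      monomial t 0 * suc t + 0 + 0   ≡⟨ cong (λ x → x + 0 + 0) (monomial-scale t 0 suc) ⟩
      monomial t 0 * 1 + 0 + 0       ≡⟨ arith (monomial t 0) ⟩
      monomial t 0                   ∎
      where
      open ≡-Reasoning
      P = Insertion.insertionCount (suc (suc m)) (λ τ → turnsW (0 ∷ τ)) σ
      t = turnsW (0 ∷ σ)
      arith : ∀ x → x * 1 + 0 + 0 ≡ x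
      arith = solve-∀

    Λ-recurrence-on : ∀ S → All (PermWord (suc m)) S → ∀ j →
      countBy udRuns (concatMap (insertEverywhere (suc (suc m))) S) (suc (suc j)) + countBy udRuns S j * j
      ≡ countBy udRuns S (suc (suc j)) * suc (suc j) + countBy udRuns S (suc j) + countBy udRuns S j * suc m
    Λ-recurrence-on [] [] j = refl
    Λ-recurrence-on (σ ∷ S) (w ∷ ws) j =
      trans (cong (_+ countBy udRuns (σ ∷ S) j * j) (countBy-concatMap udRuns (insertEverywhere (suc (suc m))) σ S (suc (suc j))))
            (add-identities₃ (countBy udRuns (insertEverywhere (suc (suc m)) σ) (suc (suc j))) (r j) (r (suc (suc j))) (r (suc j)) (r j)
                             (countBy udRuns (concatMap (insertEverywhere (suc (suc m))) S) (suc (suc j)))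
                             (countBy udRuns S j) (countBy udRuns S (suc (suc j))) (countBy udRuns S (suc j)) (countBy udRuns S j)
                             j (suc (suc j)) (suc m) (udRunLaw w j) (Λ-recurrence-on S ws j))
      where r = monomial (udRuns σ)

    Λ-recurrence₁-on : ∀ S → All (PermWord (suc m)) S →
      countBy udRuns (concatMap (insertEverywhere (suc (suc m))) S) 1 ≡ countBy udRuns S 1
    Λ-recurrence₁-on [] [] = refl
    Λ-recurrence₁-on (σ ∷ S) (w ∷ ws) =
      trans (countBy-concatMap udRuns (insertEverywhere (suc (suc m))) σ S 1) (cong₂ _+_ (udRunLaw₁ w) (Λ-recurrence₁-on S ws))

  Λ-recurrence : ∀ m j → Λ (suc (suc m)) (suc (suc j)) + Λ (suc m) j * j
    ≡ Λ (suc m) (suc (suc j)) * suc (suc j) + Λ (suc m) (suc j) + Λ (suc m) j * suc m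
  Λ-recurrence m = Λ-recurrence-on {m} (perms (suc m)) (perms-permWord (suc m))

  Λ-recurrence₁ : ∀ m → Λ (suc (suc m)) 1 ≡ Λ (suc m) 1
  Λ-recurrence₁ m = Λ-recurrence₁-on {m} (perms (suc m)) (perms-permWord (suc m))

  Λ-zero : ∀ n → Λ n 0 ≡ 0
  Λ-zero n = count-suc≡ᵇ0 (λ σ → turnsW (0 ∷ σ)) (perms n)

module Polynomials where

  open import Data.Nat as ℕ using (ℕ; zero; suc; _+_; _*_; _∸_; _≤_)
  import Data.Nat.Properties as ℕ
  open import Data.Nat.Combinatorics using (_C_; nCk+nC[k+1]≡[n+1]C[k+1]; k>n⇒nCk≡0)
  open import Data.Nat.Tactic.RingSolver using (solve-∀)
  open import Data.Bool using (true; false; if_then_else_)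
  open import Relation.Binary.PropositionalEquality
  open import Function using (_∘_)
  open Permutations using (Λ-recurrence; Λ-recurrence₁; Λ-zero; L-recurrence; L-recurrence₀)

  open Sequences ℕ.+-*-commutativeSemiring

  ×≡* : ∀ k x → k × x ≡ k * x
  ×≡* zero x = refl
  ×≡* (suc k) x = cong (x +_) (×≡* k x)

  -- With ∂ = x d/dx and X = multiplication by x: G = (1 - x²) ∂F + x F + c x² F, without subtraction.
  record ΛRecurrence (c : ℕ) (F G : ℕ → ℕ) : Set where
    field law : ∀ k → G k + X (X (∂ F)) k ≡ ∂ F k + X F k + c * X (X F) k

  -- G = (1 - x²) ∂F + c x² F
  record LRecurrence (c : ℕ) (F G : ℕ → ℕ) : Set where
    field law : ∀ k → G k + X (X (∂ F)) k ≡ ∂ F k + c * X (X F) k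

  open ΛRecurrence
  open LRecurrence

  Λpoly-recurrence : ∀ n → ΛRecurrence n (Λpoly n) (Λpoly (suc n))
  Λpoly-recurrence zero .law zero = refl
  Λpoly-recurrence zero .law (suc zero) = refl
  Λpoly-recurrence zero .law (suc (suc zero)) = refl
  Λpoly-recurrence zero .law (suc (suc (suc j))) = trans (×-zeroʳ (suc j)) (sym (cong (λ x → x + 0 + 0) (×-zeroʳ (3 + j))))
  Λpoly-recurrence (suc m) .law zero = cong₂ _+_ (Λ-zero (2 + m)) (sym (ℕ.*-zeroʳ m))
  Λpoly-recurrence (suc m) .law (suc zero) = begin
    Λ (2 + m) 1 + 0                           ≡⟨ cong (_+ 0) (Λ-recurrence₁ m) ⟩
    1 × Λ (1 + m) 1                           ≡⟨ ℕ.+-identityʳ _ ⟨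
    1 × Λ (1 + m) 1 + 0                       ≡⟨ ℕ.+-identityʳ _ ⟨
    1 × Λ (1 + m) 1 + 0 + 0                   ≡⟨ cong₂ (λ y z → 1 × Λ (1 + m) 1 + y + z) (Λ-zero (suc m)) (ℕ.*-zeroʳ (suc m)) ⟨
    1 × Λ (1 + m) 1 + Λ (1 + m) 0 + suc m * 0 ∎
    where open ≡-Reasoning
  Λpoly-recurrence (suc m) .law (suc (suc j)) = begin
    Λ (2 + m) (2 + j) + j × Λ (1 + m) j
      ≡⟨ cong (Λ (2 + m) (2 + j) +_) (trans (×≡* j (Λ (1 + m) j)) (ℕ.*-comm j (Λ (1 + m) j))) ⟩
    Λ (2 + m) (2 + j) + Λ (1 + m) j * j
      ≡⟨ Λ-recurrence m j ⟩
    Λ (1 + m) (2 + j) * (2 + j) + Λ (1 + m) (1 + j) + Λ (1 + m) j * suc m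
      ≡⟨ cong₂ (λ x y → x + Λ (1 + m) (1 + j) + y) (ℕ.*-comm (Λ (1 + m) (2 + j)) (2 + j)) (ℕ.*-comm (Λ (1 + m) j) (suc m)) ⟩
    (2 + j) * Λ (1 + m) (2 + j) + Λ (1 + m) (1 + j) + suc m * Λ (1 + m) j
      ≡⟨ cong (λ x → x + Λ (1 + m) (1 + j) + suc m * Λ (1 + m) j) (×≡* (2 + j) (Λ (1 + m) (2 + j))) ⟨
    (2 + j) × Λ (1 + m) (2 + j) + Λ (1 + m) (1 + j) + suc m * Λ (1 + m) j ∎
    where open ≡-Reasoning

  Lpoly≡L : ∀ i k → Lpoly i k ≡ L i k
  Lpoly≡L zero zero = refl
  Lpoly≡L zero (suc k) = refl
  Lpoly≡L (suc i) k = refl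

  odd⇒≡suc[2*half] : ∀ k → isOdd k ≡ true → k ≡ suc (2 * half k)
  odd⇒≡suc[2*half] (suc zero) _ = refl
  odd⇒≡suc[2*half] (suc (suc k)) odd = trans (cong (suc ∘ suc) (odd⇒≡suc[2*half] k odd)) (cong suc (arith (half k)))
    where
    arith : ∀ h → suc (suc (2 * h)) ≡ 2 * suc h
    arith = solve-∀

  L-recurrence-odd : ∀ i h → L (suc i) (suc h) + suc (2 * h) * L i h ≡ suc (suc (suc (2 * h))) * L i (suc h) + suc i * L i h
  L-recurrence-odd i h = ℕ.+-cancelʳ-≡ 0 _ _ (begin
    L (suc i) (suc h) + suc (2 * h) * L i h + 0    ≡⟨ arith₁ (L (suc i) (suc h)) (L i h) h ⟩
    (L (suc i) (suc h) + L i h * (2 * h)) + L i h  ≡⟨ cong (_+ L i h) (L-recurrence i h) ⟩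
    L i (suc h) * suc (2 * suc h) + L i h * i + L i h ≡⟨ arith₂ (L i (suc h)) (L i h) h i ⟩
    suc (suc (suc (2 * h))) * L i (suc h) + suc i * L i h + 0 ∎)
    where
    open ≡-Reasoning
    arith₁ : ∀ a b h → a + suc (2 * h) * b + 0 ≡ (a + b * (2 * h)) + b
    arith₁ = solve-∀
    arith₂ : ∀ c b h i → c * suc (2 * suc h) + b * i + b ≡ suc (suc (suc (2 * h))) * c + suc i * b + 0
    arith₂ = solve-∀

  xLsq-recurrence : ∀ i → LRecurrence (suc i) (xLsq i) (xLsq (suc i))
  xLsq-recurrence i .law zero = sym (ℕ.*-zeroʳ (suc i))
  xLsq-recurrence i .law (suc zero) = begin
    L (suc i) 0 + 0                   ≡⟨ cong (_+ 0) (trans (L-recurrence₀ i) (sym (Lpoly≡L i 0))) ⟩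
    Lpoly i 0 + 0                     ≡⟨ ℕ.+-identityʳ _ ⟨
    Lpoly i 0 + 0 + 0                 ≡⟨ cong (Lpoly i 0 + 0 +_) (ℕ.*-zeroʳ (suc i)) ⟨
    Lpoly i 0 + 0 + suc i * 0         ∎
    where open ≡-Reasoning
  xLsq-recurrence i .law (suc (suc k)) with isOdd k in odd
  ... | false = trans (×-zeroʳ k) (sym (cong₂ _+_ (×-zeroʳ (suc (suc k))) (ℕ.*-zeroʳ (suc i))))
  ... | true = begin
    L (suc i) (suc h) + k × Lpoly i h
      ≡⟨ cong₂ (λ a b → L (suc i) (suc h) + a × b) k≡ (Lpoly≡L i h) ⟩
    L (suc i) (suc h) + suc (2 * h) × L i h
      ≡⟨ cong (L (suc i) (suc h) +_) (×≡* (suc (2 * h)) (L i h)) ⟩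
    L (suc i) (suc h) + suc (2 * h) * L i h
      ≡⟨ L-recurrence-odd i h ⟩
    suc (suc (suc (2 * h))) * L i (suc h) + suc i * L i h
      ≡⟨ cong₂ (λ a b → a + suc i * b) (×≡* (suc (suc (suc (2 * h)))) (L i (suc h))) (Lpoly≡L i h) ⟨
    suc (suc (suc (2 * h))) × L i (suc h) + suc i * Lpoly i h
      ≡⟨ cong₂ (λ a b → a × b + suc i * Lpoly i h) (cong (suc ∘ suc) k≡) (Lpoly≡L i (suc h)) ⟨
    suc (suc k) × Lpoly i (suc h) + suc i * Lpoly i h ∎
    where
    open ≡-Reasoning
    h = half k
    k≡ : k ≡ suc (2 * h)
    k≡ = odd⇒≡suc[2*half] k odd

  ⋆-recurrence : ∀ {a c B B′ A A′} → LRecurrence a B B′ → ΛRecurrence c A A′ →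
    ΛRecurrence (a + c) (B ⋆ A) (λ k → (B ⋆ A′) k + (B′ ⋆ A) k)
  ⋆-recurrence {a} {c} {B} {B′} {A} {A′} recB recA .law k = begin
    (B ⋆ A′) k + (B′ ⋆ A) k + X (X (∂ (B ⋆ A))) k
      ≡⟨ cong ((B ⋆ A′) k + (B′ ⋆ A) k +_) (XX∂-⋆ B A k) ⟩
    (B ⋆ A′) k + (B′ ⋆ A) k + ((X (X (∂ B)) ⋆ A) k + (B ⋆ X (X (∂ A))) k)
      ≡⟨ arith₁ ((B ⋆ A′) k) ((B′ ⋆ A) k) ((X (X (∂ B)) ⋆ A) k) ((B ⋆ X (X (∂ A))) k) ⟩
    ((B′ ⋆ A) k + (X (X (∂ B)) ⋆ A) k) + ((B ⋆ A′) k + (B ⋆ X (X (∂ A))) k)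
      ≡⟨ cong₂ _+_ stepB stepA ⟩
    ((∂ B ⋆ A) k + a * (X (X B) ⋆ A) k) + ((B ⋆ ∂ A) k + (B ⋆ X A) k + c * (B ⋆ X (X A)) k)
      ≡⟨ cong₂ (λ x y → ((∂ B ⋆ A) k + a * x) + ((B ⋆ ∂ A) k + (B ⋆ X A) k + c * y)) XX-⋆ˡ XX-⋆ʳ ⟩
    ((∂ B ⋆ A) k + a * w) + ((B ⋆ ∂ A) k + (B ⋆ X A) k + c * w)
      ≡⟨ arith₂ ((∂ B ⋆ A) k) ((B ⋆ ∂ A) k) ((B ⋆ X A) k) w a c ⟩
    ((∂ B ⋆ A) k + (B ⋆ ∂ A) k) + (B ⋆ X A) k + (a + c) * w
      ≡⟨ cong₂ (λ x y → x + y + (a + c) * w) (∂-leibniz B A k) (X-⋆ʳ B A k) ⟨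
    ∂ (B ⋆ A) k + X (B ⋆ A) k + (a + c) * w ∎
    where
    open ≡-Reasoning
    w = X (X (B ⋆ A)) k
    XX-⋆ˡ : (X (X B) ⋆ A) k ≡ w
    XX-⋆ˡ = sym (trans (X-cong (X-⋆ˡ B A) k) (X-⋆ˡ (X B) A k))
    XX-⋆ʳ : (B ⋆ X (X A)) k ≡ w
    XX-⋆ʳ = sym (trans (X-cong (X-⋆ʳ B A) k) (X-⋆ʳ B (X A) k))
    stepB : (B′ ⋆ A) k + (X (X (∂ B)) ⋆ A) k ≡ (∂ B ⋆ A) k + a * (X (X B) ⋆ A) k
    stepB = begin
      (B′ ⋆ A) k + (X (X (∂ B)) ⋆ A) k                   ≡⟨ ⋆-distribʳ B′ (X (X (∂ B))) A k ⟨
      ((λ j → B′ j + X (X (∂ B)) j) ⋆ A) k               ≡⟨ ⋆-cong {g = A} (recB .law) (λ _ → refl) k ⟩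
      ((λ j → ∂ B j + a * X (X B) j) ⋆ A) k              ≡⟨ ⋆-distribʳ (∂ B) (λ j → a * X (X B) j) A k ⟩
      (∂ B ⋆ A) k + ((λ j → a * X (X B) j) ⋆ A) k        ≡⟨ cong ((∂ B ⋆ A) k +_) (⋆-*ˡ a (X (X B)) A k) ⟩
      (∂ B ⋆ A) k + a * (X (X B) ⋆ A) k                  ∎
    stepA : (B ⋆ A′) k + (B ⋆ X (X (∂ A))) k ≡ (B ⋆ ∂ A) k + (B ⋆ X A) k + c * (B ⋆ X (X A)) k
    stepA = begin
      (B ⋆ A′) k + (B ⋆ X (X (∂ A))) k                   ≡⟨ ⋆-distribˡ B A′ (X (X (∂ A))) k ⟨
      (B ⋆ (λ j → A′ j + X (X (∂ A)) j)) k               ≡⟨ ⋆-cong {f = B} (λ _ → refl) (recA .law) k ⟩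
      (B ⋆ (λ j → ∂ A j + X A j + c * X (X A) j)) k      ≡⟨ ⋆-distribˡ B (λ j → ∂ A j + X A j) (λ j → c * X (X A) j) k ⟩
      (B ⋆ (λ j → ∂ A j + X A j)) k + (B ⋆ (λ j → c * X (X A) j)) k
        ≡⟨ cong₂ _+_ (⋆-distribˡ B (∂ A) (X A) k) (⋆-*ʳ c B (X (X A)) k) ⟩
      (B ⋆ ∂ A) k + (B ⋆ X A) k + c * (B ⋆ X (X A)) k    ∎
    arith₁ : ∀ p q r s → p + q + (r + s) ≡ (q + r) + (p + s)
    arith₁ = solve-∀
    arith₂ : ∀ u₁ u₂ u₃ w a c → (u₁ + a * w) + (u₂ + u₃ + c * w) ≡ (u₁ + u₂) + u₃ + (a + c) * w
    arith₂ = solve-∀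

  ΛRecurrence-congˡ : ∀ {c F F′ G} → (∀ k → F k ≡ F′ k) → ΛRecurrence c F G → ΛRecurrence c F′ G
  ΛRecurrence-congˡ {c} {F} {F′} {G} F≡F′ rec .law k = begin
    G k + X (X (∂ F′)) k                  ≡⟨ cong (G k +_) (X-cong (X-cong (∂-cong F≡F′)) k) ⟨
    G k + X (X (∂ F)) k                   ≡⟨ rec .law k ⟩
    ∂ F k + X F k + c * X (X F) k
      ≡⟨ cong₂ _+_ (cong₂ _+_ (∂-cong F≡F′ k) (X-cong F≡F′ k)) (cong (c *_) (X-cong (X-cong F≡F′) k)) ⟩
    ∂ F′ k + X F′ k + c * X (X F′) k      ∎
    where open ≡-Reasoning

  ΛRecurrence-congʳ : ∀ {c F G G′} → (∀ k → G k ≡ G′ k) → ΛRecurrence c F G → ΛRecurrence c F G′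
  ΛRecurrence-congʳ {F = F} G≡G′ rec .law k = trans (cong (_+ X (X (∂ F)) k) (sym (G≡G′ k))) (rec .law k)

  ΛRecurrence-unique : ∀ {c F G G′} → ΛRecurrence c F G → ΛRecurrence c F G′ → ∀ k → G k ≡ G′ k
  ΛRecurrence-unique {F = F} rec rec′ k = ℕ.+-cancelʳ-≡ (X (X (∂ F)) k) _ _ (trans (rec .law k) (sym (rec′ .law k)))

  ΛRecurrence-∑ : ∀ {c} n (w : ℕ → ℕ) {T T′ : ℕ → ℕ → ℕ} → (∀ i → i ≤ n → ΛRecurrence c (T i) (T′ i)) →
    ΛRecurrence c (λ k → ∑ n (λ i → w i * T i k)) (λ k → ∑ n (λ i → w i * T′ i k))
  ΛRecurrence-∑ {c} n w {T} {T′} rec .law k = begin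
    ∑ n (λ i → w i * T′ i k) + X (X (∂ F)) k
      ≡⟨ cong (∑ n (λ i → w i * T′ i k) +_) XX∂F≡ ⟩
    ∑ n (λ i → w i * T′ i k) + ∑ n (λ i → w i * X (X (∂ (T i))) k)
      ≡⟨ trans (∑-cong n (λ i → ℕ.*-distribˡ-+ (w i) _ _)) (∑-distrib-+ n _ _) ⟨
    ∑ n (λ i → w i * (T′ i k + X (X (∂ (T i))) k))
      ≡⟨ ∑-cong-≤ n (λ i i≤n → cong (w i *_) (rec i i≤n .law k)) ⟩
    ∑ n (λ i → w i * (∂ (T i) k + X (T i) k + c * X (X (T i)) k))
      ≡⟨ trans (∑-cong n (λ i → arith (w i) (∂ (T i) k) (X (T i) k) (X (X (T i)) k) c))
               (trans (∑-distrib-+ n _ _) (cong₂ _+_ (∑-distrib-+ n _ _) (sym (*-distribˡ-∑ n c _)))) ⟩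
    ∑ n (λ i → w i * ∂ (T i) k) + ∑ n (λ i → w i * X (T i) k) + c * ∑ n (λ i → w i * X (X (T i)) k)
      ≡⟨ cong₂ _+_ (cong₂ _+_ (∂-∑ n w T k) (X-∑ n w T k)) (cong (c *_) XXF≡) ⟨
    ∂ F k + X F k + c * X (X F) k ∎
    where
    open ≡-Reasoning
    F : ℕ → ℕ
    F j = ∑ n (λ i → w i * T i j)
    XXF≡ : X (X F) k ≡ ∑ n (λ i → w i * X (X (T i)) k)
    XXF≡ = trans (X-cong (X-∑ n w T) k) (X-∑ n w (λ i → X (T i)) k)
    XX∂F≡ : X (X (∂ F)) k ≡ ∑ n (λ i → w i * X (X (∂ (T i))) k)
    XX∂F≡ = trans (X-cong (X-cong (∂-∑ n w T)) k)
                  (trans (X-cong (X-∑ n w (λ i → ∂ (T i))) k) (X-∑ n w (λ i → X (∂ (T i))) k))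
    arith : ∀ w α β γ c → w * (α + β + c * γ) ≡ w * α + w * β + c * (w * γ)
    arith = solve-∀

  ∑-pascal : ∀ n (w : ℕ → ℕ) → ∑ n (λ i → (n C i) * (w i + w (suc i))) ≡ ∑ (suc n) (λ i → (suc n C i) * w i)
  ∑-pascal n w = begin
    ∑ n (λ i → (n C i) * (w i + w (suc i)))
      ≡⟨ trans (∑-cong n (λ i → ℕ.*-distribˡ-+ (n C i) _ _)) (∑-distrib-+ n _ _) ⟩
    ∑ n (λ i → (n C i) * w i) + ∑ n (λ i → (n C i) * w (suc i))
      ≡⟨ cong (_+ ∑ n (λ i → (n C i) * w (suc i))) extend ⟩
    (w 0 + 0) + ∑ n (λ i → (n C suc i) * w (suc i)) + ∑ n (λ i → (n C i) * w (suc i))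
      ≡⟨ ℕ.+-assoc (w 0 + 0) _ _ ⟩
    (w 0 + 0) + (∑ n (λ i → (n C suc i) * w (suc i)) + ∑ n (λ i → (n C i) * w (suc i)))
      ≡⟨ cong ((w 0 + 0) +_) (trans (sym (∑-distrib-+ n _ _)) (∑-cong n pascal)) ⟩
    (w 0 + 0) + ∑ n (λ i → (suc n C suc i) * w (suc i))
      ≡⟨ ∑-peel n _ ⟨
    ∑ (suc n) (λ i → (suc n C i) * w i) ∎
    where
    open ≡-Reasoning
    pascal : ∀ i → (n C suc i) * w (suc i) + (n C i) * w (suc i) ≡ (suc n C suc i) * w (suc i)
    pascal i = trans (sym (ℕ.*-distribʳ-+ (w (suc i)) (n C suc i) (n C i)))
               (cong (_* w (suc i)) (trans (ℕ.+-comm (n C suc i) (n C i)) (nCk+nC[k+1]≡[n+1]C[k+1] n i)))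
    extend : ∑ n (λ i → (n C i) * w i) ≡ (w 0 + 0) + ∑ n (λ i → (n C suc i) * w (suc i))
    extend = begin
      ∑ n (λ i → (n C i) * w i)             ≡⟨ ℕ.+-identityʳ _ ⟨
      ∑ n (λ i → (n C i) * w i) + 0
        ≡⟨ cong (λ x → ∑ n (λ i → (n C i) * w i) + x * w (suc n)) (k>n⇒nCk≡0 (ℕ.n<1+n n)) ⟨
      ∑ (suc n) (λ i → (n C i) * w i)       ≡⟨ ∑-peel n _ ⟩
      (w 0 + 0) + ∑ n (λ i → (n C suc i) * w (suc i)) ∎

  binomialSum : ℕ → ℕ → ℕ
  binomialSum n k = ∑ n (λ i → (n C i) * (xLsq i ⋆ Λpoly (n ∸ i)) k)

  binomialSum-recurrence : ∀ n → ΛRecurrence (suc n) (binomialSum n) (binomialSum (suc n))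
  binomialSum-recurrence n = ΛRecurrence-congʳ (λ k → ∑-pascal n (λ i → (xLsq i ⋆ Λpoly (suc n ∸ i)) k))
    (ΛRecurrence-∑ n (n C_) term-recurrence)
    where
    term-recurrence : ∀ i → i ≤ n → ΛRecurrence (suc n) (xLsq i ⋆ Λpoly (n ∸ i))
      (λ k → (xLsq i ⋆ Λpoly (suc n ∸ i)) k + (xLsq (suc i) ⋆ Λpoly (n ∸ i)) k)
    term-recurrence i i≤n rewrite ℕ.+-∸-assoc 1 i≤n =
      subst (λ c → ΛRecurrence c (xLsq i ⋆ Λpoly (n ∸ i))
                    (λ k → (xLsq i ⋆ Λpoly (suc (n ∸ i))) k + (xLsq (suc i) ⋆ Λpoly (n ∸ i)) k))
            (cong suc (ℕ.m+[n∸m]≡n i≤n))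
        (⋆-recurrence (xLsq-recurrence i) (Λpoly-recurrence (n ∸ i)))

  Λpoly-binomialSum : ∀ n k → Λpoly (suc n) k ≡ binomialSum n k
  Λpoly-binomialSum zero k = sym (begin
    1 * (xLsq 0 ⋆ Λpoly 0) k    ≡⟨ ℕ.*-identityˡ _ ⟩
    (xLsq 0 ⋆ Λpoly 0) k        ≡⟨ ⋆-cong {f = xLsq 0} (λ _ → refl) Λpoly₀≡δ k ⟩
    (xLsq 0 ⋆ δ) k              ≡⟨ ⋆-identityʳ (xLsq 0) k ⟩
    xLsq 0 k                    ≡⟨ xLsq₀≡Λpoly₁ k ⟩
    Λpoly 1 k                   ∎)
    where
    open ≡-Reasoning
    Λpoly₀≡δ : ∀ k → Λpoly 0 k ≡ δ k
    Λpoly₀≡δ zero = refl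
    Λpoly₀≡δ (suc k) = refl
    xLsq₀≡Λpoly₁ : ∀ k → xLsq 0 k ≡ Λpoly 1 k
    xLsq₀≡Λpoly₁ zero = refl
    xLsq₀≡Λpoly₁ (suc zero) = refl
    xLsq₀≡Λpoly₁ (suc (suc k)) with isOdd k
    ... | true = refl
    ... | false = refl
  Λpoly-binomialSum (suc n) = ΛRecurrence-unique
    (ΛRecurrence-congˡ (Λpoly-binomialSum n) (Λpoly-recurrence (suc n)))
    (binomialSum-recurrence n)

module FormalSeries where

  open import Data.Nat as ℕ using (ℕ; zero; suc; _∸_; _≤_; _!)
  import Data.Nat.Properties as ℕ
  open import Data.Nat.Combinatorics using (_C_; nCk≡n!/k![n-k]!; k![n∸k]!∣n!)
  open import Data.Nat.DivMod using (m/n*n≡m)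
  open import Data.Integer as ℤ using (+_)
  import Data.Integer.Properties as ℤ
  open import Data.Rational as ℚ using (ℚ; 0ℚ; 1ℚ; _+_; _*_; _/_; toℚᵘ)
  import Data.Rational.Properties as ℚ
  open import Data.Rational.Unnormalised as ℚᵘ using (mkℚᵘ; _≃_; *≡*)
  import Data.Rational.Unnormalised.Properties as ℚᵘ
  open import Relation.Binary.PropositionalEquality
  import Relation.Binary.Reasoning.Setoid as SetoidReasoning
  open import Data.Rational.Solver using (module +-*-Solver)
  open Polynomials using (binomialSum; Λpoly-binomialSum)

  ι : ℕ → ℚ
  ι n = + n / 1

  private
    module ≃-Reasoning = SetoidReasoning ℚᵘ.≃-setoid

    toℚᵘ-ι : ∀ n → toℚᵘ (ι n) ≃ mkℚᵘ (+ n) 0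
    toℚᵘ-ι n = ℚ.toℚᵘ-fromℚᵘ (mkℚᵘ (+ n) 0)

  ι-+ : ∀ m n → ι (m ℕ.+ n) ≡ ι m + ι n
  ι-+ m n = ℚ.toℚᵘ-injective (begin
    toℚᵘ (ι (m ℕ.+ n))                ≈⟨ toℚᵘ-ι (m ℕ.+ n) ⟩
    mkℚᵘ (+ (m ℕ.+ n)) 0              ≈⟨ *≡* (trans (ℤ.*-identityʳ _) (trans (ℤ.pos-+ m n) (sym (trans (ℤ.*-identityʳ _)
                                            (cong₂ ℤ._+_ (ℤ.*-identityʳ (+ m)) (ℤ.*-identityʳ (+ n))))))) ⟩
    mkℚᵘ (+ m) 0 ℚᵘ.+ mkℚᵘ (+ n) 0    ≈⟨ ℚᵘ.+-cong (toℚᵘ-ι m) (toℚᵘ-ι n) ⟨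
    toℚᵘ (ι m) ℚᵘ.+ toℚᵘ (ι n)        ≈⟨ ℚ.toℚᵘ-homo-+ (ι m) (ι n) ⟨
    toℚᵘ (ι m + ι n)                  ∎)
    where open ≃-Reasoning

  ι-* : ∀ m n → ι (m ℕ.* n) ≡ ι m * ι n
  ι-* m n = ℚ.toℚᵘ-injective (begin
    toℚᵘ (ι (m ℕ.* n))                ≈⟨ toℚᵘ-ι (m ℕ.* n) ⟩
    mkℚᵘ (+ (m ℕ.* n)) 0              ≈⟨ *≡* (cong (ℤ._* + 1) (ℤ.pos-* m n)) ⟩
    mkℚᵘ (+ m) 0 ℚᵘ.* mkℚᵘ (+ n) 0    ≈⟨ ℚᵘ.*-cong (toℚᵘ-ι m) (toℚᵘ-ι n) ⟨
    toℚᵘ (ι m) ℚᵘ.* toℚᵘ (ι n)        ≈⟨ ℚ.toℚᵘ-homo-* (ι m) (ι n) ⟨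
    toℚᵘ (ι m * ι n)                  ∎)
    where open ≃-Reasoning

  /-*-ι : ∀ a d .{{_ : ℕ.NonZero d}} → (+ a / d) * ι d ≡ ι a
  /-*-ι a (suc d) = ℚ.toℚᵘ-injective (begin
    toℚᵘ ((+ a / suc d) * ι (suc d))              ≈⟨ ℚ.toℚᵘ-homo-* (+ a / suc d) (ι (suc d)) ⟩
    toℚᵘ (+ a / suc d) ℚᵘ.* toℚᵘ (ι (suc d))      ≈⟨ ℚᵘ.*-cong (ℚ.toℚᵘ-fromℚᵘ (mkℚᵘ (+ a) d)) (toℚᵘ-ι (suc d)) ⟩
    mkℚᵘ (+ a) d ℚᵘ.* mkℚᵘ (+ suc d) 0            ≈⟨ *≡* (trans (ℤ.*-identityʳ _) (cong (λ x → + a ℤ.* + suc x) (sym (ℕ.*-identityʳ d)))) ⟩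
    mkℚᵘ (+ a) 0                                  ≈⟨ toℚᵘ-ι a ⟨
    toℚᵘ (ι a)                                    ∎)
    where open ≃-Reasoning

  *-cancelʳ-ι : ∀ d .{{_ : ℕ.NonZero d}} {p q} → p * ι d ≡ q * ι d → p ≡ q
  *-cancelʳ-ι d {p} {q} eq = begin
    p                      ≡⟨ ℚ.*-identityʳ p ⟨
    p * 1ℚ                 ≡⟨ cong (p *_) ι*1/≡1 ⟨
    p * (ι d * (+ 1 / d))  ≡⟨ ℚ.*-assoc p _ _ ⟨
    p * ι d * (+ 1 / d)    ≡⟨ cong (_* (+ 1 / d)) eq ⟩
    q * ι d * (+ 1 / d)    ≡⟨ ℚ.*-assoc q _ _ ⟩
    q * (ι d * (+ 1 / d))  ≡⟨ cong (q *_) ι*1/≡1 ⟩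
    q * 1ℚ                 ≡⟨ ℚ.*-identityʳ q ⟩
    q                      ∎
    where
    open ≡-Reasoning
    ι*1/≡1 : ι d * (+ 1 / d) ≡ 1ℚ
    ι*1/≡1 = trans (ℚ.*-comm (ι d) (+ 1 / d)) (/-*-ι 1 d)

  ℚ-semiring : CommutativeSemiring _ _
  ℚ-semiring = CommutativeRing.commutativeSemiring ℚ.+-*-commutativeRing

  module ℕ⟦x⟧ = Sequences ℕ.+-*-commutativeSemiring
  module ℚ⟦x⟧ = Sequences ℚ-semiring
  module ℚ⟦x⟧⟦t⟧ = Sequences ℚ⟦x⟧.seqSemiring

  ×≡ι* : ∀ n q → n ℚ⟦x⟧.× q ≡ ι n * q
  ×≡ι* zero q = sym (ℚ.*-zeroˡ q)
  ×≡ι* (suc n) q = begin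
    q + n ℚ⟦x⟧.× q      ≡⟨ cong₂ _+_ (sym (ℚ.*-identityˡ q)) (×≡ι* n q) ⟩
    1ℚ * q + ι n * q    ≡⟨ ℚ.*-distribʳ-+ q 1ℚ (ι n) ⟨
    (1ℚ + ι n) * q      ≡⟨ cong (_* q) (ι-+ 1 n) ⟨
    ι (suc n) * q       ∎
    where open ≡-Reasoning

  ι-∑ : ∀ n f → ι (ℕ⟦x⟧.∑ n f) ≡ ℚ⟦x⟧.∑ n (λ i → ι (f i))
  ι-∑ zero f = refl
  ι-∑ (suc n) f = trans (ι-+ (ℕ⟦x⟧.∑ n f) (f (suc n))) (cong (_+ ι (f (suc n))) (ι-∑ n f))

  ∑≡Σ≤ : ∀ n f → ℚ⟦x⟧.∑ n f ≡ Σ≤ n f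
  ∑≡Σ≤ zero f = refl
  ∑≡Σ≤ (suc n) f = cong (_+ f (suc n)) (∑≡Σ≤ n f)

  ×-pointwise : ∀ n (f : ℕ → ℚ) k → (n ℚ⟦x⟧⟦t⟧.× f) k ≡ n ℚ⟦x⟧.× f k
  ×-pointwise zero f k = refl
  ×-pointwise (suc n) f k = cong (λ x → f k + x) (×-pointwise n f k)

  ∑-pointwise : ∀ n (F : ℕ → ℕ → ℚ) k → ℚ⟦x⟧⟦t⟧.∑ n F k ≡ ℚ⟦x⟧.∑ n (λ i → F i k)
  ∑-pointwise zero F k = refl
  ∑-pointwise (suc n) F k = cong (_+ F (suc n) k) (∑-pointwise n F k)

  ×-cancel : ∀ n {f g : ℕ → ℚ} → (∀ k → (suc n ℚ⟦x⟧⟦t⟧.× f) k ≡ (suc n ℚ⟦x⟧⟦t⟧.× g) k) → ∀ k → f k ≡ g k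
  ×-cancel n {f} {g} eq k = *-cancelʳ-ι (suc n) (begin
    f k * ι (suc n)            ≡⟨ ℚ.*-comm (f k) _ ⟩
    ι (suc n) * f k            ≡⟨ trans (×-pointwise (suc n) f k) (×≡ι* (suc n) (f k)) ⟨
    (suc n ℚ⟦x⟧⟦t⟧.× f) k      ≡⟨ eq k ⟩
    (suc n ℚ⟦x⟧⟦t⟧.× g) k      ≡⟨ trans (×-pointwise (suc n) g k) (×≡ι* (suc n) (g k)) ⟩
    ι (suc n) * g k            ≡⟨ ℚ.*-comm _ (g k) ⟩
    g k * ι (suc n)            ∎)
    where open ≡-Reasoning

  1/! : ℕ → ℕ → ℚ
  1/! m zero = (+ 1 / m !) {{m ℕ.!≢0}}
  1/! m (suc k) = 0ℚ

  suc-*-1/! : ∀ a n → ι (suc n) * (+ a / suc n !) {{suc n ℕ.!≢0}} * ι (n !) ≡ ι a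
  suc-*-1/! a n = begin
    ι (suc n) * q * ι (n !)       ≡⟨ cong (_* ι (n !)) (ℚ.*-comm (ι (suc n)) q) ⟩
    q * ι (suc n) * ι (n !)       ≡⟨ ℚ.*-assoc q (ι (suc n)) (ι (n !)) ⟩
    q * (ι (suc n) * ι (n !))     ≡⟨ cong (q *_) (ι-* (suc n) (n !)) ⟨
    q * ι (suc n !)               ≡⟨ /-*-ι a (suc n !) {{suc n ℕ.!≢0}} ⟩
    ι a                           ∎
    where
    open ≡-Reasoning
    q = (+ a / suc n !) {{suc n ℕ.!≢0}}

  1/!-recurrence : ∀ m k → (suc m ℚ⟦x⟧⟦t⟧.× 1/! (suc m)) k ≡ 1/! m k
  1/!-recurrence m zero = begin
    (suc m ℚ⟦x⟧⟦t⟧.× 1/! (suc m)) 0    ≡⟨ trans (×-pointwise (suc m) (1/! (suc m)) 0) (×≡ι* (suc m) _) ⟩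
    ι (suc m) * 1/! (suc m) 0          ≡⟨ *-cancelʳ-ι (m !) {{m ℕ.!≢0}} (trans (suc-*-1/! 1 m) (sym (/-*-ι 1 (m !) {{m ℕ.!≢0}}))) ⟩
    1/! m 0                            ∎
    where open ≡-Reasoning
  1/!-recurrence m (suc k) = trans (×-pointwise (suc m) (1/! (suc m)) (suc k)) (ℚ⟦x⟧.×-zeroʳ (suc m))

  module Exp = ℚ⟦x⟧⟦t⟧.Exponential innerSeries (λ _ → refl) 1/! 1/!-recurrence

  ⋆-1/! : ∀ (f : ℕ → ℚ) m k → (f ℚ⟦x⟧.⋆ 1/! m) k ≡ f k * 1/! m 0
  ⋆-1/! f m k = trans (ℚ⟦x⟧.⋆-comm f (1/! m) k) (trans (scale k) (ℚ.*-comm (1/! m 0) (f k)))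
    where
    scale : ∀ k → (1/! m ℚ⟦x⟧.⋆ f) k ≡ 1/! m 0 * f k
    scale zero = refl
    scale (suc k) = trans (ℚ⟦x⟧.∑-peel k _)
      (trans (cong (λ x → 1/! m 0 * f (suc k) + x) (ℚ⟦x⟧.∑-zero k (λ i _ → ℚ.*-zeroˡ (f (k ∸ i))))) (ℚ.+-identityʳ _))

  G^≡^S : ∀ m n k → (Exp.G^ m) n k ≡ (innerSeries ^S m) n k
  G^≡^S zero zero zero = refl
  G^≡^S zero zero (suc k) = refl
  G^≡^S zero (suc n) k = refl
  G^≡^S (suc m) n k = begin
    ℚ⟦x⟧⟦t⟧.∑ n (λ i → innerSeries i ℚ⟦x⟧.⋆ (Exp.G^ m) (n ∸ i)) k
      ≡⟨ ∑-pointwise n (λ i → innerSeries i ℚ⟦x⟧.⋆ (Exp.G^ m) (n ∸ i)) k ⟩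
    ℚ⟦x⟧.∑ n (λ i → ℚ⟦x⟧.∑ k (λ j → innerSeries i j * (Exp.G^ m) (n ∸ i) (k ∸ j)))
      ≡⟨ trans (∑≡Σ≤ n _) (Σ≤-cong n (λ i → trans (∑≡Σ≤ k _)
           (Σ≤-cong k (λ j → cong (innerSeries i j *_) (G^≡^S m (n ∸ i) (k ∸ j)))))) ⟩
    (innerSeries ⊛ (innerSeries ^S m)) n k ∎
    where
    open ≡-Reasoning
    Σ≤-cong : ∀ n {f g : ℕ → ℚ} → (∀ i → f i ≡ g i) → Σ≤ n f ≡ Σ≤ n g
    Σ≤-cong zero f≡g = f≡g zero
    Σ≤-cong (suc n) f≡g = cong₂ _+_ (Σ≤-cong n f≡g) (f≡g (suc n))

  exp≡expS : ∀ n k → Exp.exp n k ≡ expS innerSeries n k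
  exp≡expS n k = begin
    ℚ⟦x⟧⟦t⟧.∑ n (λ m → (Exp.G^ m) n ℚ⟦x⟧.⋆ 1/! m) k
      ≡⟨ ∑-pointwise n _ k ⟩
    ℚ⟦x⟧.∑ n (λ m → ((Exp.G^ m) n ℚ⟦x⟧.⋆ 1/! m) k)
      ≡⟨ ℚ⟦x⟧.∑-cong n (λ m → trans (⋆-1/! ((Exp.G^ m) n) m k) (cong (_* 1/! m 0) (G^≡^S m n k))) ⟩
    ℚ⟦x⟧.∑ n (λ m → (innerSeries ^S m) n k * 1/! m 0)
      ≡⟨ ∑≡Σ≤ n _ ⟩
    expS innerSeries n k                                      ∎
    where open ≡-Reasoning

  binomial*factorials : ∀ {n i} → i ≤ n → (n C i) ℕ.* (i ! ℕ.* (n ∸ i) !) ≡ n !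
  binomial*factorials {n} {i} i≤n =
    trans (cong (ℕ._* (i ! ℕ.* (n ∸ i) !)) (nCk≡n!/k![n-k]! i≤n))
          (m/n*n≡m {{ℕ._!*_!≢0 i (n ∸ i)}} (k![n∸k]!∣n! i≤n))

  module _ (n k : ℕ) where

    open ℚ⟦x⟧⟦t⟧ using (∂; _⋆_)

    private
      ∂G = ∂ innerSeries

    lhs-term : ∀ i j → i ≤ n →
      ∂G (suc i) j * lhsSeries (n ∸ i) (k ∸ j) * ι (n !) ≡ ι ((n C i) ℕ.* (xLsq i j ℕ.* Λpoly (n ∸ i) (k ∸ j)))
    lhs-term i j i≤n = begin
      ∂G (suc i) j * q * ι (n !)
        ≡⟨ cong₂ (λ x y → x * q * y) (trans (×-pointwise (suc i) (innerSeries (suc i)) j) (×≡ι* (suc i) _)) n!≡ ⟩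
      ι (suc i) * p * q * (ι c * (ι (i !) * ι ((n ∸ i) !)))
        ≡⟨ rearrange (ι (suc i)) p q (ι c) (ι (i !)) (ι ((n ∸ i) !)) ⟩
      ι c * ((ι (suc i) * p * ι (i !)) * (q * ι ((n ∸ i) !)))
        ≡⟨ cong (λ x → ι c * x) (cong₂ _*_ (suc-*-1/! b i) (/-*-ι a ((n ∸ i) !) {{(n ∸ i) ℕ.!≢0}})) ⟩
      ι c * (ι b * ι a)
        ≡⟨ trans (ι-* c (b ℕ.* a)) (cong (ι c *_) (ι-* b a)) ⟨
      ι (c ℕ.* (b ℕ.* a)) ∎
      where
      open ≡-Reasoning
      open +-*-Solver
      a = Λpoly (n ∸ i) (k ∸ j)
      b = xLsq i j
      c = n C i
      p = (+ b / suc i !) {{suc i ℕ.!≢0}}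
      q = lhsSeries (n ∸ i) (k ∸ j)
      n!≡ : ι (n !) ≡ ι c * (ι (i !) * ι ((n ∸ i) !))
      n!≡ = trans (cong ι (sym (binomial*factorials i≤n))) (trans (ι-* c _) (cong (ι c *_) (ι-* (i !) ((n ∸ i) !))))
      rearrange : ∀ s p q c f g → s * p * q * (c * (f * g)) ≡ c * ((s * p * f) * (q * g))
      rearrange = solve 6 (λ s p q c f g → s :* p :* q :* (c :* (f :* g)) := c :* ((s :* p :* f) :* (q :* g))) refl

    lhs-equation : (suc n ℚ⟦x⟧⟦t⟧.× lhsSeries (suc n)) k ≡ (∂G ⋆ lhsSeries) (suc n) k
    lhs-equation = *-cancelʳ-ι (n !) {{n ℕ.!≢0}} (trans left (sym right))
      where
      open ≡-Reasoning
      left : (suc n ℚ⟦x⟧⟦t⟧.× lhsSeries (suc n)) k * ι (n !) ≡ ι (Λpoly (suc n) k)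
      left = trans (cong (_* ι (n !)) (trans (×-pointwise (suc n) (lhsSeries (suc n)) k) (×≡ι* (suc n) _)))
                   (suc-*-1/! (Λpoly (suc n) k) n)
      term : ℕ → ℕ → ℚ
      term i j = ∂G i j * lhsSeries (suc n ∸ i) (k ∸ j) * ι (n !)
      right : (∂G ⋆ lhsSeries) (suc n) k * ι (n !) ≡ ι (Λpoly (suc n) k)
      right = begin
        (∂G ⋆ lhsSeries) (suc n) k * ι (n !)
          ≡⟨ cong (_* ι (n !)) (∑-pointwise (suc n) _ k) ⟩
        ℚ⟦x⟧.∑ (suc n) (λ i → (∂G i ℚ⟦x⟧.⋆ lhsSeries (suc n ∸ i)) k) * ι (n !)
          ≡⟨ trans (ℚ⟦x⟧.*-distribʳ-∑ (suc n) _ _) (ℚ⟦x⟧.∑-cong (suc n) (λ i → ℚ⟦x⟧.*-distribʳ-∑ k _ _)) ⟩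
        ℚ⟦x⟧.∑ (suc n) (λ i → ℚ⟦x⟧.∑ k (term i))
          ≡⟨ ℚ⟦x⟧.∑-peel n _ ⟩
        ℚ⟦x⟧.∑ k (term 0) + ℚ⟦x⟧.∑ n (λ i → ℚ⟦x⟧.∑ k (term (suc i)))
          ≡⟨ cong₂ _+_ (ℚ⟦x⟧.∑-zero k (λ j _ → trans (cong (_* ι (n !)) (ℚ.*-zeroˡ (lhsSeries (suc n) (k ∸ j)))) (ℚ.*-zeroˡ (ι (n !)))))
                       (ℚ⟦x⟧.∑-cong-≤ n (λ i i≤n → ℚ⟦x⟧.∑-cong k (λ j → lhs-term i j i≤n))) ⟩
        0ℚ + ℚ⟦x⟧.∑ n (λ i → ℚ⟦x⟧.∑ k (λ j → ι ((n C i) ℕ.* (xLsq i j ℕ.* Λpoly (n ∸ i) (k ∸ j)))))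
          ≡⟨ ℚ.+-identityˡ _ ⟩
        ℚ⟦x⟧.∑ n (λ i → ℚ⟦x⟧.∑ k (λ j → ι ((n C i) ℕ.* (xLsq i j ℕ.* Λpoly (n ∸ i) (k ∸ j)))))
          ≡⟨ ℚ⟦x⟧.∑-cong n (λ i → trans (sym (ι-∑ k _)) (cong ι (sym (ℕ⟦x⟧.*-distribˡ-∑ k (n C i) _)))) ⟩
        ℚ⟦x⟧.∑ n (λ i → ι ((n C i) ℕ.* (xLsq i ℕ⟦x⟧.⋆ Λpoly (n ∸ i)) k))
          ≡⟨ ι-∑ n _ ⟨
        ι (binomialSum n k)
          ≡⟨ cong ι (Λpoly-binomialSum n k) ⟨
        ι (Λpoly (suc n) k) ∎

  lhs≡exp : ∀ n k → lhsSeries n k ≡ Exp.exp n k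
  lhs≡exp = ℚ⟦x⟧⟦t⟧.∂-equation-unique ×-cancel {innerSeries} base lhs-equation (λ n → Exp.∂-exp (suc n))
    where
    base : ∀ k → lhsSeries 0 k ≡ Exp.exp 0 k
    base zero = refl
    base (suc k) = sym (trans (⋆-1/! ℚ⟦x⟧.δ 0 (suc k)) (ℚ.*-zeroˡ (1/! 0 0)))

open FormalSeries using (lhs≡exp; exp≡expS)

theorem3p2 : (n k : ℕ) → lhsSeries n k ≡ expS innerSeries n k
theorem3p2 n k = ≡.trans (lhs≡exp n k) (exp≡expS n k)
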